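{- Let $n\ge 2$. For every $k\ge0$, $V_{2k+1,n}^+\in\mathcal{P}_n^\circ$. Moreover, if $k\le\frac n2$, then $V_{2k+1,n}^+=2^{2k}P_{k,n}^\circ+\sum_{l<k}a^\circ_{k,l,n}P^\circ_{l,n}$ for some constants $a^\circ_{k,l,n}$. Hence $\{V^+_{2k+1,n}:0\le k\le\lfloor\frac n2\rfloor\}$ is a basis of $\mathcal{P}_n^\circ$.
   Context: A composition of $n$ is a sequence $I=(i_1,\dots,i_r)$ of positive integers summing to $n$; its descent set is $\{i_1,i_1+i_2,\dots,i_1+\dots+i_{r-1}\}$. Let $\mathbf{Sym}=\bigoplus_{n\ge0}\mathbf{Sym}_n$ be the algebra of noncommutative symmetric functions over $\mathbb{Q}$, with ribbon basis $R_I$ (and $R_\emptyset=1$ in degree $0$). Identify $\mathbf{Sym}_n$ with the descent algebra $\mathcal{D}_n\subseteq\mathbb{Q}[\mathfrak{S}_n]$ via $R_I\mapsto\sum\{\sigma:\mathrm{Des}(\sigma)=\text{descent set of }I\}$, where $\mathrm{Des}(\sigma)=\{i:\sigma(i)>\sigma(i+1)\}$. The external product $\star$ is $R_{(i_1,\dots,i_r)}\star R_{(j_1,\dots,j_s)}=R_{(i_1,\dots,i_r,j_1,\dots,j_s)}+R_{(i_1,\dots,i_{r-1},i_r+j_1,j_2,\dots,j_s)}$, extended to the completion $\widehat{\mathbf{Sym}}$ of formal sums of homogeneous elements. Let $V_1^+=\sum_{i\ge0}R_{(i)}$, $V_1^-=\sum_{i\ge0}R_{(1^i)}$, $V_{2k+1}^+=V_1^+\star(V_1^-\star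 V_1^+)^{\star k}$, and let $V_{2k+1,n}^+$ be its degree-$n$ component. A left peak of $\sigma\in\mathfrak{S}_n$ is $i$ with $1\le i\le n-1$ and $\sigma(i-1)<\sigma(i)>\sigma(i+1)$, with convention $\sigma(0)=0$; $P^\circ_{l,n}$ is the sum of all $\sigma\in\mathfrak{S}_n$ with exactly $l$ left peaks (zero if none), and $\mathcal{P}_n^\circ=\mathrm{span}\{P^\circ_{l,n}:0\le l\le\lfloor\frac n2\rfloor\}$ is the Eulerian left peak algebra. -}

module Defs where

open import Data.Bool using (Bool; true; false; if_then_else_; _∧_)
open import Data.Nat as ℕ using (ℕ; zero; suc; _<ᵇ_; _≡ᵇ_; _∸_; _<?_)
open import Data.Fin using (Fin; toℕ; fromℕ<)
open import Data.Fin.Permutation using (Permutation′; _⟨$⟩ʳ_)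
open import Data.List using (List; []; _∷_; map; upTo; filterᵇ; length; foldr; replicate; _++_; concatMap)
open import Data.List.Properties using (≡-dec)
open import Data.Product using (_×_; _,_)
open import Data.Rational using (ℚ; 0ℚ; 1ℚ; _+_; _*_)
open import Relation.Nullary using (does; yes; no)

-- Permutations σ ∈ 𝔖ₙ, viewed 1-indexed with values in 1..n,
-- and with the convention σ(0) = 0 (values outside 1..n are 0).

val : {n : ℕ} → Permutation′ n → ℕ → ℕ
val σ zero = zero
val {n} σ (suc i) with i <? n
... | yes p = suc (toℕ (σ ⟨$⟩ʳ fromℕ< p))
... | no _  = zero

Des : {n : ℕ} → Permutation′ n → List ℕ
Des {n} σ = filterᵇ (λ i → val σ (suc i) <ᵇ val σ i) (map suc (upTo (n ∸ 1)))

lpk : {n : ℕ} → Permutation′ n → ℕ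
lpk {n} σ = length (filterᵇ (λ i → (val σ (i ∸ 1) <ᵇ val σ i) ∧ (val σ (suc i) <ᵇ val σ i))
                             (map suc (upTo (n ∸ 1))))

-- Elements of ℚ[𝔖ₙ] are represented as functions 𝔖ₙ → ℚ (coefficient of σ);
-- equality is pointwise.

sumℚ : List ℚ → ℚ
sumℚ = foldr _+_ 0ℚ

Pcirc : (l n : ℕ) → Permutation′ n → ℚ
Pcirc l n σ = if lpk σ ≡ᵇ l then 1ℚ else 0ℚ

-- Noncommutative symmetric functions, ribbon basis.
-- A composition is a list of positive integers; a (homogeneous) element is a
-- finite formal ℚ-linear combination of ribbons R_I.

Comp : Set
Comp = List ℕ

Elem : Set
Elem = List (ℚ × Comp)

descSet : Comp → List ℕ
descSet [] = []
descSet (i ∷ []) = []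
descSet (i ∷ j ∷ rest) = i ∷ map (i ℕ.+_) (descSet (j ∷ rest))

-- identification Sym_n ≅ 𝒟_n ⊆ ℚ[𝔖ₙ] : R_I ↦ Σ{σ : Des(σ) = descent set of I}
ev : (n : ℕ) → Elem → Permutation′ n → ℚ
ev n x σ = sumℚ (map (λ { (c , I) → if does (≡-dec ℕ._≟_ (descSet I) (Des σ)) then c else 0ℚ }) x)

lastMerge : Comp → Comp → Comp
lastMerge [] J = J
lastMerge (i ∷ []) [] = i ∷ []
lastMerge (i ∷ []) (j ∷ J) = (i ℕ.+ j) ∷ J
lastMerge (i ∷ i' ∷ I) J = i ∷ lastMerge (i' ∷ I) J

ribbonProd : Comp → Comp → Elem
ribbonProd [] J = (1ℚ , J) ∷ []
ribbonProd I [] = (1ℚ , I) ∷ []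
ribbonProd I J = (1ℚ , I ++ J) ∷ (1ℚ , lastMerge I J) ∷ []

prodE : Elem → Elem → Elem
prodE x y = concatMap (λ { (a , I) → concatMap (λ { (b , J) →
              map (λ { (c , K) → (a * b * c , K) }) (ribbonProd I J) }) y }) x

-- elements of the completion: degree ↦ homogeneous component
Series : Set
Series = ℕ → Elem

_⋆_ : Series → Series → Series
(A ⋆ B) d = concatMap (λ a → prodE (A a) (B (d ∸ a))) (upTo (suc d))

unitS : Series
unitS zero = (1ℚ , []) ∷ []
unitS (suc _) = []

_^⋆_ : Series → ℕ → Series
X ^⋆ zero = unitS
X ^⋆ suc k = X ⋆ (X ^⋆ k)

V1plus : Series
V1plus zero = (1ℚ , []) ∷ []
V1plus (suc i) = (1ℚ , suc i ∷ []) ∷ []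

V1minus : Series
V1minus i = (1ℚ , replicate i 1) ∷ []

Vplus : ℕ → Series
Vplus k = V1plus ⋆ ((V1minus ⋆ V1plus) ^⋆ k)

Vn : (k n : ℕ) → Permutation′ n → ℚ
Vn k n = ev n (Vplus k n)

lin : ℕ → (ℕ → ℚ) → (ℕ → ℚ) → ℚ
lin m c f = sumℚ (map (λ i → c i * f i) (upTo m))

pow2 : ℕ → ℚ
pow2 zero = 1ℚ
pow2 (suc m) = (1ℚ + 1ℚ) * pow2 m

module Submission where

-- Both V⁺_{2k+1,n}(σ) and the left peaks of σ depend only on the descent word of σ, a word of
-- length n - 1 in ascents and descents. Expanding V₁⁺ ⋆ (V₁⁻ ⋆ V₁⁺)^{⋆k} in ribbons, the coefficient
-- of a word is computed by a transfer recursion on its letters. Two local moves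
-- (des asc asc ↦ des des asc and asc asc des ↦ asc des des) preserve this coefficient and bring every
-- word to a normal form determined by its length and its number of peaks, so V⁺_{2k+1,n} lies in
-- the span of the P°_{l,n}. The same recursion shows that the coefficient vanishes on words with more
-- than k peaks and equals 4^k on words with exactly k peaks. As every l ≤ n/2 is the number of
-- left peaks of some permutation, the resulting triangular system gives the basis.

open import Defs
open import Data.Nat using (ℕ; suc; _≤_; _/_; _*_)
open import Data.Product using (_×_; ∃)
open import Data.Rational using (ℚ; 0ℚ) renaming (_+_ to _+ℚ_; _*_ to _*ℚ_)
open import Data.Fin.Permutation using (Permutation′)
open import Relation.Binary.PropositionalEquality using (_≡_)

open import Algebra.Bundles using (CommutativeMonoid)
open import Data.Bool using (Bool; true; false; if_then_else_; not; _∧_)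
open import Data.Bool.Properties using (not-involutive)
open import Data.Empty using (⊥-elim)
open import Data.Fin using (Fin; toℕ; fromℕ<)
open import Data.Fin.Permutation using (_⟨$⟩ʳ_; _⟨$⟩ˡ_; inverseˡ; permutation)
open import Data.Fin.Properties using (toℕ-fromℕ<; toℕ-injective; fromℕ<-cong; toℕ<n)
open import Data.List using (List; []; _∷_; replicate; _++_; length; map; concatMap; upTo; applyUpTo; take; drop; filterᵇ)
open import Data.List.Properties
  using (++-identityʳ; ++-assoc; length-++; length-replicate; length-map; length-take; length-drop; map-++; map-cong;
         map-∘; map-id; map-applyUpTo; ∷-injective; ≡-dec; concatMap-cong; map-concatMap)
open import Data.List.Relation.Unary.All as All using (All; []; _∷_)
open import Data.List.Relation.Unary.All.Properties using (++⁺; concat⁺; map⁺; applyUpTo⁺₁)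
open import Data.Nat as ℕ using (zero; _+_; _^_; _<_; z≤n; s≤s; _∸_; ⌈_/2⌉; _<ᵇ_; _≡ᵇ_)
open import Data.Nat.DivMod using (m*n/n≡m; /-monoˡ-≤; m/n*n≤m)
open import Data.Nat.Properties
open import Data.Nat.Solver using (module +-*-Solver)
open import Data.Product using (_,_; proj₁; proj₂; ∃-syntax)
open import Data.Rational using (1ℚ; NonZero; NonNegative; 1/_; -_)
import Data.Rational.Properties as ℚ
open import Data.Sum using (_⊎_; inj₁; inj₂)
open import Relation.Binary.Definitions using (Tri; tri<; tri≈; tri>)
open import Relation.Binary.PropositionalEquality using (_≢_; refl; sym; trans; cong; cong₂; subst; module ≡-Reasoning)
open import Relation.Nullary using (does; yes; no)
open import Algebra.Properties.CommutativeSemigroup (CommutativeMonoid.commutativeSemigroup ℚ.+-0-commutativeMonoid)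
  using () renaming (interchange to +ℚ-interchange)

open +-*-Solver using (solve; _:+_; _:*_; _:=_; con)

-- Descent words

pattern asc = false
pattern des = true

Word : Set
Word = List Bool

sumBelow : (ℕ → ℕ) → ℕ → ℕ
sumBelow f zero    = 0
sumBelow f (suc r) = sumBelow f r + f r

sumBelow-cong : ∀ {f g} → (∀ r → f r ≡ g r) → ∀ n → sumBelow f n ≡ sumBelow g n
sumBelow-cong e zero    = refl
sumBelow-cong e (suc n) = cong₂ _+_ (sumBelow-cong e n) (e n)

sumBelow-zero : ∀ f n → (∀ r → r < n → f r ≡ 0) → sumBelow f n ≡ 0
sumBelow-zero f zero    h = refl
sumBelow-zero f (suc n) h = cong₂ _+_ (sumBelow-zero f n (λ r r<n → h r (m<n⇒m<1+n r<n))) (h n ≤-refl)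

odd : ℕ → Bool
odd zero    = false
odd (suc r) = not (odd r)

double : ℕ → ℕ
double zero    = zero
double (suc t) = suc (suc (double t))

odd-double : ∀ t → odd (double t) ≡ false
odd-double zero    = refl
odd-double (suc t) rewrite odd-double t = refl

odd-suc-double : ∀ t → odd (suc (double t)) ≡ true
odd-suc-double t rewrite odd-double t = refl

double-or-suc-double : ∀ r → ∃[ t ] (r ≡ double t ⊎ r ≡ suc (double t))
double-or-suc-double zero          = 0 , inj₁ refl
double-or-suc-double (suc zero)    = 0 , inj₂ refl
double-or-suc-double (suc (suc r)) with double-or-suc-double r
... | t , inj₁ e = suc t , inj₁ (cong (λ z → suc (suc z)) e)
... | t , inj₂ e = suc t , inj₂ (cong (λ z → suc (suc z)) e)

⌈double/2⌉ : ∀ t → ⌈ double t /2⌉ ≡ t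
⌈double/2⌉ zero    = refl
⌈double/2⌉ (suc t) = cong suc (⌈double/2⌉ t)

⌈suc-double/2⌉ : ∀ t → ⌈ suc (double t) /2⌉ ≡ suc t
⌈suc-double/2⌉ zero    = refl
⌈suc-double/2⌉ (suc t) = cong suc (⌈suc-double/2⌉ t)

⌈/2⌉-<-from-even : ∀ {a b} → a < b → odd a ≡ false → ⌈ a /2⌉ < ⌈ b /2⌉
⌈/2⌉-<-from-even {zero}        {suc b}       _ _ = s≤s z≤n
⌈/2⌉-<-from-even {suc (suc a)} {suc (suc b)} (s≤s (s≤s a<b)) e =
  s≤s (⌈/2⌉-<-from-even a<b (trans (sym (not-involutive (odd a))) e))

⌈/2⌉-<-to-odd : ∀ {a b} → a < b → odd b ≡ true → ⌈ a /2⌉ < ⌈ b /2⌉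
⌈/2⌉-<-to-odd {zero}        {suc b}       _ _ = s≤s z≤n
⌈/2⌉-<-to-odd {suc zero}    {suc (suc (suc b))} _ _ = s≤s (⌈n/2⌉-mono {1} {suc b} (s≤s z≤n))
⌈/2⌉-<-to-odd {suc (suc a)} {suc (suc b)} (s≤s (s≤s a<b)) e =
  s≤s (⌈/2⌉-<-to-odd a<b (trans (sym (not-involutive (odd b))) e))
⌈/2⌉-<-to-odd {suc zero}    {suc (suc zero)} _ ()
⌈/2⌉-<-to-odd {suc zero}    {suc zero} (s≤s ()) _

-- ways r w is defined so that Σ_{r<N} ways r w is the coefficient of the ribbon with descent word w
-- in the alternating product ⋯ ⋆ V₁⁻ ⋆ V₁⁺ of N factors (coeff-alt).

step : Bool → (ℕ → ℕ) → ℕ → ℕ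
step asc f r = sumBelow f r + (if odd r then 0 else f r)
step des f r = sumBelow f r + (if odd r then f r else 0)

ways : ℕ → Word → ℕ
ways r []      = 1
ways r (x ∷ w) = step x (λ r′ → ways r′ w) r

step-cong : ∀ x {f g} → (∀ r → f r ≡ g r) → ∀ r → step x f r ≡ step x g r
step-cong asc e r with odd r
... | true  = cong (_+ 0) (sumBelow-cong e r)
... | false = cong₂ _+_ (sumBelow-cong e r) (e r)
step-cong des e r with odd r
... | true  = cong₂ _+_ (sumBelow-cong e r) (e r)
... | false = cong (_+ 0) (sumBelow-cong e r)

step-zero : ∀ x f r → (∀ r′ → r′ ≤ r → f r′ ≡ 0) → step x f r ≡ 0
step-zero asc f r h with odd r
... | true  = cong (_+ 0) (sumBelow-zero f r (λ r′ p → h r′ (<⇒≤ p)))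
... | false = cong₂ _+_ (sumBelow-zero f r (λ r′ p → h r′ (<⇒≤ p))) (h r ≤-refl)
step-zero des f r h with odd r
... | false = cong (_+ 0) (sumBelow-zero f r (λ r′ p → h r′ (<⇒≤ p)))
... | true  = cong₂ _+_ (sumBelow-zero f r (λ r′ p → h r′ (<⇒≤ p))) (h r ≤-refl)

stepD-odd : ∀ f r → odd r ≡ true → step des f r ≡ sumBelow f r + f r
stepD-odd f r e rewrite e = refl

stepD-even : ∀ f r → odd r ≡ false → step des f r ≡ sumBelow f r + 0
stepD-even f r e rewrite e = refl

stepA-odd : ∀ f r → odd r ≡ true → step asc f r ≡ sumBelow f r + 0
stepA-odd f r e rewrite e = refl

stepA-even : ∀ f r → odd r ≡ false → step asc f r ≡ sumBelow f r + f r
stepA-even f r e rewrite e = refl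

stepA-pairs : ∀ f t → step asc f (double t) ≡ step asc f (suc (double t))
stepA-pairs f t rewrite odd-double t = sym (+-identityʳ _)

stepD-pairs : ∀ f t → step des f (suc (double t)) ≡ step des f (double (suc t))
stepD-pairs f t rewrite odd-double t = sym (+-identityʳ _)

-- When g takes equal values on each pair {2t, 2t+1} (as step asc f does), a descent preceded by
-- an ascent or by a descent gives the same ways; dually for the pairs {2t+1, 2t+2}. These are the
-- local moves DAA≋DDA and AAD≋ADD below.

sumBelow-stepA≡stepD-at-even : ∀ g → (∀ t → g (double t) ≡ g (suc (double t))) →
  ∀ t → sumBelow (step asc g) (double t) ≡ sumBelow (step des g) (double t)
sumBelow-stepA≡stepD-at-even g pairs zero = refl
sumBelow-stepA≡stepD-at-even g pairs (suc t) = begin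
    (sumBelow (step asc g) (double t) + step asc g (double t)) + step asc g (suc (double t))
  ≡⟨ cong₂ _+_ (cong₂ _+_ (sumBelow-stepA≡stepD-at-even g pairs t) (stepA-even g (double t) (odd-double t)))
               (stepA-odd g (suc (double t)) (odd-suc-double t)) ⟩
    (Y + (X + a)) + ((X + a) + 0)
  ≡⟨ solve 3 (λ Y X a → (Y :+ (X :+ a)) :+ ((X :+ a) :+ con 0) := (Y :+ (X :+ con 0)) :+ ((X :+ a) :+ a)) refl Y X a ⟩
    (Y + (X + 0)) + ((X + a) + a)
  ≡⟨ cong₂ _+_ (cong (Y +_) (sym (stepD-even g (double t) (odd-double t))))
               (trans (cong ((X + a) +_) (pairs t)) (sym (stepD-odd g (suc (double t)) (odd-suc-double t)))) ⟩
    (Y + step des g (double t)) + step des g (suc (double t)) ∎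
  where
  open ≡-Reasoning
  Y = sumBelow (step des g) (double t)
  X = sumBelow g (double t)
  a = g (double t)

sumBelow-stepA≡stepD-at-odd : ∀ g → g 0 ≡ 0 → (∀ t → g (suc (double t)) ≡ g (double (suc t))) →
  ∀ t → sumBelow (step asc g) (suc (double t)) ≡ sumBelow (step des g) (suc (double t))
sumBelow-stepA≡stepD-at-odd g g0 pairs zero = g0
sumBelow-stepA≡stepD-at-odd g g0 pairs (suc t) = begin
    (sumBelow (step asc g) (suc (double t)) + step asc g (suc (double t))) + step asc g (double (suc t))
  ≡⟨ cong₂ _+_ (cong₂ _+_ (sumBelow-stepA≡stepD-at-odd g g0 pairs t) (stepA-odd g (suc (double t)) (odd-suc-double t)))
               (stepA-even g (double (suc t)) (odd-double (suc t))) ⟩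
    (Y + (X + 0)) + ((X + a) + g (double (suc t)))
  ≡⟨ cong (λ z → (Y + (X + 0)) + ((X + a) + z)) (sym (pairs t)) ⟩
    (Y + (X + 0)) + ((X + a) + a)
  ≡⟨ solve 3 (λ Y X a → (Y :+ (X :+ con 0)) :+ ((X :+ a) :+ a) := (Y :+ (X :+ a)) :+ ((X :+ a) :+ con 0)) refl Y X a ⟩
    (Y + (X + a)) + ((X + a) + 0)
  ≡⟨ cong₂ _+_ (cong (Y +_) (sym (stepD-odd g (suc (double t)) (odd-suc-double t))))
               (sym (stepD-even g (double (suc t)) (odd-double (suc t)))) ⟩
    (Y + step des g (suc (double t))) + step des g (double (suc t)) ∎
  where
  open ≡-Reasoning
  Y = sumBelow (step des g) (suc (double t))
  X = sumBelow g (suc (double t))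
  a = g (suc (double t))

stepD∘A≗stepD∘D : ∀ g → (∀ t → g (double t) ≡ g (suc (double t))) →
                  ∀ r → step des (step asc g) r ≡ step des (step des g) r
stepD∘A≗stepD∘D g pairs r with double-or-suc-double r
... | t , inj₁ refl =
  trans (stepD-even (step asc g) (double t) (odd-double t))
    (trans (cong (_+ 0) (sumBelow-stepA≡stepD-at-even g pairs t))
           (sym (stepD-even (step des g) (double t) (odd-double t))))
... | t , inj₂ refl =
  trans (stepD-odd (step asc g) (suc (double t)) (odd-suc-double t))
    (trans (sumBelow-stepA≡stepD-at-even g pairs (suc t))
           (sym (stepD-odd (step des g) (suc (double t)) (odd-suc-double t))))

stepA∘A≗stepA∘D : ∀ g → g 0 ≡ 0 → (∀ t → g (suc (double t)) ≡ g (double (suc t))) →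
                  ∀ r → step asc (step asc g) r ≡ step asc (step des g) r
stepA∘A≗stepA∘D g g0 pairs r with double-or-suc-double r
... | zero , inj₁ refl = g0
... | suc t , inj₁ refl =
  trans (stepA-even (step asc g) (double (suc t)) (odd-double (suc t)))
    (trans (sumBelow-stepA≡stepD-at-odd g g0 pairs (suc t))
           (sym (stepA-even (step des g) (double (suc t)) (odd-double (suc t)))))
... | t , inj₂ refl =
  trans (stepA-odd (step asc g) (suc (double t)) (odd-suc-double t))
    (trans (cong (_+ 0) (sumBelow-stepA≡stepD-at-odd g g0 pairs t))
           (sym (stepA-odd (step des g) (suc (double t)) (odd-suc-double t))))

-- A left peak is a descent preceded by an ascent; the word is read as if it
-- started after an ascent, matching σ(0) = 0.

peaksAfter : Bool → Word → ℕ
peaksAfter p   []        = 0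
peaksAfter p   (asc ∷ w) = peaksAfter asc w
peaksAfter asc (des ∷ w) = suc (peaksAfter des w)
peaksAfter des (des ∷ w) = peaksAfter des w

peaks : Word → ℕ
peaks = peaksAfter asc

startsWithDes : Word → Bool
startsWithDes []      = false
startsWithDes (x ∷ _) = x

peaks≡0⇒startsWithAsc : ∀ w → peaks w ≡ 0 → startsWithDes w ≡ false
peaks≡0⇒startsWithAsc []        _ = refl
peaks≡0⇒startsWithAsc (asc ∷ w) _ = refl

if-false : ∀ {A : Set} {b} {x y : A} → b ≡ false → (if b then x else y) ≡ y
if-false refl = refl

if-true : ∀ {A : Set} {b} {x y : A} → b ≡ true → (if b then x else y) ≡ x
if-true refl = refl

odd-cases : ∀ r → odd r ≡ true ⊎ odd r ≡ false
odd-cases r with odd r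
... | true  = inj₁ refl
... | false = inj₂ refl

ways-vanish-DA : ∀ u → (∀ r → ⌈ r /2⌉ < peaks u → ways r u ≡ 0) →
  (∀ r → ⌈ r /2⌉ < peaks (asc ∷ u) → ways r (asc ∷ u) ≡ 0) →
  ∀ r → ⌈ r /2⌉ < peaks (des ∷ asc ∷ u) → ways r (des ∷ asc ∷ u) ≡ 0
ways-vanish-DA u vanish vanishA r r<peaks = atParity (odd-cases r)
  where
  f = λ r′ → ways r′ (asc ∷ u)
  r≤peaks = ≤-pred r<peaks
  atOdd : ∀ r′ → ⌈ r′ /2⌉ ≤ peaks u → odd r′ ≡ true → f r′ ≡ 0
  atOdd r′ q o = trans (stepA-odd (λ r″ → ways r″ u) r′ o)
    (cong (_+ 0) (sumBelow-zero _ r′ (λ r″ p → vanish r″ (<-≤-trans (⌈/2⌉-<-to-odd p o) q))))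
  earlier : ∀ r′ → r′ < r → odd r′ ≡ true ⊎ odd r′ ≡ false → f r′ ≡ 0
  earlier r′ r′<r (inj₁ o) = atOdd r′ (≤-trans (⌈n/2⌉-mono (<⇒≤ r′<r)) r≤peaks) o
  earlier r′ r′<r (inj₂ e) = vanishA r′ (<-≤-trans (⌈/2⌉-<-from-even r′<r e) r≤peaks)
  below : sumBelow f r ≡ 0
  below = sumBelow-zero f r (λ r′ r′<r → earlier r′ r′<r (odd-cases r′))
  atParity : odd r ≡ true ⊎ odd r ≡ false → step des f r ≡ 0
  atParity (inj₁ o) = trans (stepD-odd f r o) (cong₂ _+_ below (atOdd r r≤peaks o))
  atParity (inj₂ e) = trans (stepD-even f r e) (cong (_+ 0) below)

ways-vanish : ∀ w r → ⌈ r /2⌉ < peaks w → ways r w ≡ 0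
ways-vanish (asc ∷ v) r h =
  step-zero asc _ r (λ r′ p → ways-vanish v r′ (≤-<-trans (⌈n/2⌉-mono p) h))
ways-vanish (des ∷ []) zero _ = refl
ways-vanish (des ∷ []) (suc zero) (s≤s ())
ways-vanish (des ∷ []) (suc (suc r)) (s≤s ())
ways-vanish (des ∷ des ∷ u) r h =
  step-zero des _ r (λ r′ p → ways-vanish (des ∷ u) r′ (≤-<-trans (⌈n/2⌉-mono p) h))
ways-vanish (des ∷ asc ∷ u) r h = ways-vanish-DA u (ways-vanish u) (ways-vanish (asc ∷ u)) r h

-- The coefficient of the ribbon with descent word w in V⁺_{2k+1} (countWord-Vᶜ)
vWord : ℕ → Word → ℕ
vWord k w = sumBelow (λ r → ways r w) (suc (double k))

vWord-vanish : ∀ k w → k < peaks w → vWord k w ≡ 0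
vWord-vanish k w k<peaks = sumBelow-zero _ (suc (double k))
  (λ r r≤2k → ways-vanish w r (≤-<-trans (subst (⌈ r /2⌉ ≤_) (⌈double/2⌉ k) (⌈n/2⌉-mono (≤-pred r≤2k))) k<peaks))

⌊4^_/2⌋ : ℕ → ℕ
⌊4^ zero  /2⌋ = 0
⌊4^ suc s /2⌋ = 2 * 4 ^ s

fourPow-split : ∀ b t → (0 + (if b then 2 * 4 ^ t else 0)) + (if b then ⌊4^ suc t /2⌋ else 4 ^ suc t) ≡ 4 ^ suc t
fourPow-split true  t = solve 1 (λ x → (con 2 :* x) :+ (con 2 :* x) := con 4 :* x) refl (4 ^ t)
fourPow-split false t = refl

mutual
  ways-even-top : ∀ w s → peaks w ≡ s → ways (double s) w ≡ (if startsWithDes w then ⌊4^ s /2⌋ else 4 ^ s)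
  ways-even-top []        .0 refl = refl
  ways-even-top (asc ∷ v) s  e    = trans (stepA-even _ (double s) (odd-double s)) (vWord-top s v e)
  ways-even-top (des ∷ []) .1 refl = refl
  ways-even-top (des ∷ v@(asc ∷ u)) .(suc (peaks u)) refl =
    trans (stepD-even _ (double (suc t)) (odd-double (suc t)))
      (trans (cong (_+ 0) (cong₂ _+_ (cong₂ _+_ (sumBelow-ways-at-even v t refl refl) (ways-even-top v t refl))
                                      (trans (sym (stepA-pairs _ t)) (ways-even-top v t refl))))
        (solve 1 (λ x → ((con 0 :+ x) :+ x) :+ con 0 := con 2 :* x) refl (4 ^ t)))
    where
    t = peaks u
  ways-even-top (des ∷ v@(des ∷ u)) (suc t) e =
    trans (stepD-even _ (double (suc t)) (odd-double (suc t)))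
      (trans (cong (_+ 0) (cong₂ _+_ (vWord-vanish t v (≤-reflexive (sym e))) (ways-odd-top v t e))) (+-identityʳ _))

  ways-odd-top : ∀ w s → peaks w ≡ suc s → ways (suc (double s)) w ≡ (if startsWithDes w then 2 * 4 ^ s else 0)
  ways-odd-top (asc ∷ v) s e =
    trans (stepA-odd _ (suc (double s)) (odd-suc-double s)) (cong (_+ 0) (vWord-vanish s v (≤-reflexive (sym e))))
  ways-odd-top (des ∷ []) zero refl = refl
  ways-odd-top (des ∷ v@(asc ∷ u)) .(peaks u) refl =
    trans (stepD-odd _ (suc (double s)) (odd-suc-double s))
      (trans (cong₂ _+_ (cong₂ _+_ (sumBelow-ways-at-even v s refl refl) (ways-even-top v s refl))
                        (trans (sym (stepA-pairs _ s)) (ways-even-top v s refl)))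
        (solve 1 (λ x → (con 0 :+ x) :+ x := con 2 :* x) refl (4 ^ s)))
    where
    s = peaks u
  ways-odd-top (des ∷ v@(des ∷ u)) s e =
    trans (stepD-odd _ (suc (double s)) (odd-suc-double s))
      (cong₂ _+_ (vWord-vanish s v (≤-reflexive (sym e))) (ways-odd-top v s e))

  sumBelow-ways-at-even : ∀ v t → peaks v ≡ t → startsWithDes v ≡ false → sumBelow (λ r → ways r v) (double t) ≡ 0
  sumBelow-ways-at-even v zero    e s = refl
  sumBelow-ways-at-even v (suc t) e s =
    cong₂ _+_ (vWord-vanish t v (≤-reflexive (sym e))) (trans (ways-odd-top v t e) (if-false s))

  vWord-top : ∀ k w → peaks w ≡ k → vWord k w ≡ 4 ^ k
  vWord-top zero    w e = trans (ways-even-top w 0 e) (if-false (peaks≡0⇒startsWithAsc w e))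
  vWord-top (suc t) w e =
    trans (cong₂ _+_ (cong₂ _+_ (vWord-vanish t w (≤-reflexive (sym e))) (ways-odd-top w t e)) (ways-even-top w (suc t) e))
      (fourPow-split (startsWithDes w) t)

record _≋_ (w w′ : Word) : Set where
  constructor mk≋
  field same-ways : ∀ r → ways r w ≡ ways r w′
open _≋_

≋-refl : ∀ {w} → w ≋ w
≋-refl = mk≋ (λ r → refl)

≋-sym : ∀ {w w′} → w ≋ w′ → w′ ≋ w
≋-sym e = mk≋ (λ r → sym (same-ways e r))

≋-trans : ∀ {u v w} → u ≋ v → v ≋ w → u ≋ w
≋-trans e f = mk≋ (λ r → trans (same-ways e r) (same-ways f r))

∷-≋ : ∀ x {w w′} → w ≋ w′ → (x ∷ w) ≋ (x ∷ w′)
∷-≋ x e = mk≋ (step-cong x (same-ways e))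

≡⇒≋ : ∀ {w w′} → w ≡ w′ → w ≋ w′
≡⇒≋ refl = ≋-refl

AAD≋ADD : ∀ s → (asc ∷ asc ∷ des ∷ s) ≋ (asc ∷ des ∷ des ∷ s)
AAD≋ADD s = mk≋ (stepA∘A≗stepA∘D _ refl (stepD-pairs (λ r → ways r s)))

DAA≋DDA : ∀ s → (des ∷ asc ∷ asc ∷ s) ≋ (des ∷ des ∷ asc ∷ s)
DAA≋DDA s = mk≋ (stepD∘A≗stepD∘D _ (stepA-pairs (λ r → ways r s)))

DA≋DD : (des ∷ asc ∷ []) ≋ (des ∷ des ∷ [])
DA≋DD = mk≋ (stepD∘A≗stepD∘D (λ _ → 1) (λ t → refl))

-- Normal forms: a word with b ≥ 1 peaks is ≋ to [asc] des desᵐ (asc des)^(b-1), keeping its first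
-- letter, and a word without peaks is ascᵐ. (normalForm des 0 is junk: a word starting with des has a peak.)

peakTail : ℕ → Word
peakTail zero    = []
peakTail (suc b) = asc ∷ des ∷ peakTail b

desForm : ℕ → ℕ → Word
desForm b m = des ∷ (replicate m des ++ peakTail b)

normalForm : Bool → ℕ → ℕ → Word
normalForm asc zero    m = replicate m asc
normalForm asc (suc b) m = asc ∷ desForm b m
normalForm des zero    m = []
normalForm des (suc b) m = desForm b m

normalLength : Bool → ℕ → ℕ → ℕ
normalLength asc zero    m = m
normalLength asc (suc b) m = 2 + m + double b
normalLength des zero    m = 0
normalLength des (suc b) m = suc (m + double b)

desAscᵐ≋desDesᵐ : ∀ m → (des ∷ replicate m asc) ≋ (des ∷ replicate m des)
desAscᵐ≋desDesᵐ zero          = ≋-refl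
desAscᵐ≋desDesᵐ (suc zero)    = DA≋DD
desAscᵐ≋desDesᵐ (suc (suc m)) = ≋-trans (DAA≋DDA (replicate m asc)) (∷-≋ des (desAscᵐ≋desDesᵐ (suc m)))

DAD-slide : ∀ m s → (des ∷ asc ∷ des ∷ (replicate m des ++ s)) ≋ (des ∷ (replicate m des ++ (asc ∷ des ∷ s)))
DAD-slide zero    s = ≋-refl
DAD-slide (suc m) s =
  ≋-trans (∷-≋ des (≋-sym (AAD≋ADD u))) (≋-trans (DAA≋DDA (des ∷ u)) (∷-≋ des (DAD-slide m s)))
  where u = replicate m des ++ s

asc∷normalForm : ∀ b m w → w ≋ normalForm asc b m → (asc ∷ w) ≋ normalForm asc b (suc m)
asc∷normalForm zero    m w e = ∷-≋ asc {w} {replicate m asc} e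
asc∷normalForm (suc b) m w e = ≋-trans (∷-≋ asc {w} {asc ∷ desForm b m} e) (AAD≋ADD (replicate m des ++ peakTail b))

des∷normalForm : ∀ b m w → w ≋ normalForm asc b m → (des ∷ w) ≋ desForm b m
des∷normalForm zero m w e =
  ≋-trans (∷-≋ des {w} {replicate m asc} e)
          (≋-trans (desAscᵐ≋desDesᵐ m) (≡⇒≋ (cong (des ∷_) (sym (++-identityʳ _)))))
des∷normalForm (suc b) m w e = ≋-trans (∷-≋ des {w} {asc ∷ desForm b m} e) (DAD-slide m (peakTail b))

normalLength-des∷ : ∀ b m → suc (normalLength asc b m) ≡ suc (m + double b)
normalLength-des∷ zero    m = cong suc (sym (+-identityʳ m))
normalLength-des∷ (suc b) m = cong suc (solve 2 (λ m d → con 2 :+ m :+ d := m :+ (con 2 :+ d)) refl m (double b))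

normalise : ∀ w → ∃[ m ] (w ≋ normalForm (startsWithDes w) (peaks w) m
                          × length w ≡ normalLength (startsWithDes w) (peaks w) m)
normalise [] = 0 , ≋-refl , refl
normalise (asc ∷ []) = 1 , ≋-refl , refl
normalise (asc ∷ w@(asc ∷ v)) with normalise w
... | m , e , l = suc m , asc∷normalForm (peaks v) m w e , lengthStep (peaks v) l
  where
  lengthStep : ∀ b → length w ≡ normalLength asc b m → suc (length w) ≡ normalLength asc b (suc m)
  lengthStep zero    l = cong suc l
  lengthStep (suc b) l = cong suc l
normalise (asc ∷ w@(des ∷ v)) with normalise w
... | m , e , l = m , ∷-≋ asc {w} {desForm (peaksAfter des v) m} e , cong suc l
normalise (des ∷ []) = 0 , ≋-refl , refl
normalise (des ∷ w@(asc ∷ v)) with normalise w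
... | m , e , l = m , des∷normalForm (peaks v) m w e , trans (cong suc l) (normalLength-des∷ (peaks v) m)
normalise (des ∷ w@(des ∷ v)) with normalise w
... | m , e , l = suc m , ∷-≋ des {w} {desForm (peaksAfter des v) m} e , cong suc l

vWord-≋ : ∀ k {w w′} → w ≋ w′ → vWord k w ≡ vWord k w′
vWord-≋ k e = sumBelow-cong (same-ways e) _

vWord-AD≡DD : ∀ k s → vWord k (asc ∷ des ∷ s) ≡ vWord k (des ∷ des ∷ s)
vWord-AD≡DD k s = sumBelow-stepA≡stepD-at-odd _ refl (stepD-pairs (λ r → ways r s)) k

vWordOfShape : ℕ → ℕ → ℕ → ℕ
vWordOfShape k zero    L = vWord k (replicate L asc)
vWordOfShape k (suc b) L = vWord k (desForm b (L ∸ suc (double b)))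

vWord-ascNormal : ∀ k b m w → w ≋ normalForm asc b m → length w ≡ normalLength asc b m →
                  vWord k w ≡ vWordOfShape k b (length w)
vWord-ascNormal k zero    m w e l rewrite l = vWord-≋ k e
vWord-ascNormal k (suc b) m w e l rewrite l =
  trans (vWord-≋ k e) (trans (vWord-AD≡DD k (replicate m des ++ peakTail b))
    (cong (λ z → vWord k (desForm b z)) (sym (m+n∸n≡m (suc m) (double b)))))

vWord-by-shape : ∀ k w → vWord k w ≡ vWordOfShape k (peaks w) (length w)
vWord-by-shape k [] = refl
vWord-by-shape k (asc ∷ v) with normalise (asc ∷ v)
... | m , e , l = vWord-ascNormal k (peaks v) m (asc ∷ v) e l
vWord-by-shape k (des ∷ v) with normalise (des ∷ v)
... | m , e , l = trans (vWord-≋ k e) (cong (λ z → vWord k (desForm (peaksAfter des v) z))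
       (sym (trans (cong (_∸ suc (double (peaksAfter des v))) l) (m+n∸n≡m m (double (peaksAfter des v))))))

-- An element of Sym with ℕ-coefficients, recorded by its coefficient of R_∅ and, for each word w,
-- the coefficient of the ribbon of degree length w + 1 whose descent word is w.

record WordSeries : Set where
  constructor wordSeries
  field
    const : ℕ
    coeff : Word → ℕ
open WordSeries

infix 4 _≐_
_≐_ : WordSeries → WordSeries → Set
f ≐ g = (const f ≡ const g) × (∀ w → coeff f w ≡ coeff g w)

≐-refl : ∀ {f} → f ≐ f
≐-refl = refl , λ w → refl

≐-trans : ∀ {f g h} → f ≐ g → g ≐ h → f ≐ h
≐-trans (a , b) (a′ , b′) = trans a a′ , λ w → trans (b w) (b′ w)

∂ : Bool → WordSeries → WordSeries
∂ x f = wordSeries (coeff f []) (λ u → coeff f (x ∷ u))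

-- R_I ⋆ R_J is the sum of the ribbons with words u des v and u asc v (u, v the words of I, J), so the
-- coefficient of w in f ⋆ g sums f(u) g(v) over w = u x v, plus the terms where f or g has degree 0.
prodCoeff : WordSeries → WordSeries → Word → ℕ
prodCoeff f g []      = const f * coeff g [] + coeff f [] * const g
prodCoeff f g (x ∷ w) = const f * coeff g (x ∷ w) + prodCoeff (∂ x f) g w

infixl 7 _⊛_
_⊛_ : WordSeries → WordSeries → WordSeries
f ⊛ g = wordSeries (const f * const g) (prodCoeff f g)

_⊕_ : WordSeries → WordSeries → WordSeries
f ⊕ g = wordSeries (const f + const g) (λ u → coeff f u + coeff g u)

_⊙_ : ℕ → WordSeries → WordSeries
k ⊙ f = wordSeries (k * const f) (λ u → k * coeff f u)

prodCoeff-⊕ˡ : ∀ f f′ g w → prodCoeff (f ⊕ f′) g w ≡ prodCoeff f g w + prodCoeff f′ g w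
prodCoeff-⊕ˡ f f′ g [] =
  solve 6 (λ a a′ b x x′ y → (a :+ a′) :* b :+ (x :+ x′) :* y := (a :* b :+ x :* y) :+ (a′ :* b :+ x′ :* y)) refl
    (const f) (const f′) (coeff g []) (coeff f []) (coeff f′ []) (const g)
prodCoeff-⊕ˡ f f′ g (x ∷ w) rewrite prodCoeff-⊕ˡ (∂ x f) (∂ x f′) g w =
  solve 5 (λ a a′ b p p′ → (a :+ a′) :* b :+ (p :+ p′) := (a :* b :+ p) :+ (a′ :* b :+ p′)) refl
    (const f) (const f′) (coeff g (x ∷ w)) (prodCoeff (∂ x f) g w) (prodCoeff (∂ x f′) g w)

prodCoeff-⊙ˡ : ∀ k f g w → prodCoeff (k ⊙ f) g w ≡ k * prodCoeff f g w
prodCoeff-⊙ˡ k f g [] =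
  solve 5 (λ k a b x y → (k :* a) :* b :+ (k :* x) :* y := k :* (a :* b :+ x :* y)) refl
    k (const f) (coeff g []) (coeff f []) (const g)
prodCoeff-⊙ˡ k f g (x ∷ w) rewrite prodCoeff-⊙ˡ k (∂ x f) g w =
  solve 4 (λ k a b p → (k :* a) :* b :+ k :* p := k :* (a :* b :+ p)) refl
    k (const f) (coeff g (x ∷ w)) (prodCoeff (∂ x f) g w)

prodCoeff-assoc : ∀ f g h w → prodCoeff (f ⊛ g) h w ≡ prodCoeff f (g ⊛ h) w
prodCoeff-assoc f g h [] =
  solve 6 (λ a b c x z y → (a :* b) :* c :+ (a :* y :+ x :* b) :* z := a :* (b :* c :+ y :* z) :+ x :* (b :* z)) refl
    (const f) (const g) (coeff h []) (coeff f []) (const h) (coeff g [])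
prodCoeff-assoc f g h (x ∷ w) = begin
    (a * b) * c + prodCoeff ((a ⊙ ∂ x g) ⊕ (∂ x f ⊛ g)) h w
  ≡⟨ cong ((a * b) * c +_) (prodCoeff-⊕ˡ (a ⊙ ∂ x g) (∂ x f ⊛ g) h w) ⟩
    (a * b) * c + (prodCoeff (a ⊙ ∂ x g) h w + prodCoeff (∂ x f ⊛ g) h w)
  ≡⟨ cong₂ (λ p q → (a * b) * c + (p + q)) (prodCoeff-⊙ˡ a (∂ x g) h w) (prodCoeff-assoc (∂ x f) g h w) ⟩
    (a * b) * c + (a * prodCoeff (∂ x g) h w + prodCoeff (∂ x f) (g ⊛ h) w)
  ≡⟨ solve 5 (λ a b c p q → (a :* b) :* c :+ (a :* p :+ q) := a :* (b :* c :+ p) :+ q) refl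
       a b c (prodCoeff (∂ x g) h w) (prodCoeff (∂ x f) (g ⊛ h) w) ⟩
    a * (b * c + prodCoeff (∂ x g) h w) + prodCoeff (∂ x f) (g ⊛ h) w ∎
  where
  open ≡-Reasoning
  a = const f
  b = const g
  c = coeff h (x ∷ w)

⊛-assoc : ∀ f g h → (f ⊛ g) ⊛ h ≐ f ⊛ (g ⊛ h)
⊛-assoc f g h = *-assoc (const f) (const g) (const h) , prodCoeff-assoc f g h

prodCoeff-cong : ∀ {f f′ g g′} → f ≐ f′ → g ≐ g′ → ∀ w → prodCoeff f g w ≡ prodCoeff f′ g′ w
prodCoeff-cong (ef , pf) (eg , pg) []      = cong₂ _+_ (cong₂ _*_ ef (pg [])) (cong₂ _*_ (pf []) eg)
prodCoeff-cong (ef , pf) (eg , pg) (x ∷ w) =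
  cong₂ _+_ (cong₂ _*_ ef (pg (x ∷ w))) (prodCoeff-cong (pf [] , λ u → pf (x ∷ u)) (eg , pg) w)

⊛-cong : ∀ {f f′ g g′} → f ≐ f′ → g ≐ g′ → f ⊛ g ≐ f′ ⊛ g′
⊛-cong ef eg = cong₂ _*_ (proj₁ ef) (proj₁ eg) , prodCoeff-cong ef eg

allAsc : Word → ℕ
allAsc []        = 1
allAsc (asc ∷ u) = allAsc u
allAsc (des ∷ u) = 0

allDes : Word → ℕ
allDes []        = 1
allDes (des ∷ u) = allDes u
allDes (asc ∷ u) = 0

rowS colS oneS zeroS : WordSeries
rowS  = wordSeries 1 allAsc
colS  = wordSeries 1 allDes
oneS  = wordSeries 1 (λ _ → 0)
zeroS = wordSeries 0 (λ _ → 0)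

prodCoeff-zeroˡ : ∀ g w → prodCoeff zeroS g w ≡ 0
prodCoeff-zeroˡ g []      = refl
prodCoeff-zeroˡ g (x ∷ w) = prodCoeff-zeroˡ g w

prodCoeff-oneˡ : ∀ g w → prodCoeff oneS g w ≡ coeff g w
prodCoeff-oneˡ g []      = trans (+-identityʳ _) (+-identityʳ _)
prodCoeff-oneˡ g (x ∷ w) = trans (cong₂ _+_ (+-identityʳ _) (prodCoeff-zeroˡ g w)) (+-identityʳ _)

waysBelow : ℕ → Word → ℕ
waysBelow n w = sumBelow (λ r → ways r w) n

alt⁺ alt⁻ : ℕ → WordSeries
alt⁺ zero    = rowS ⊛ oneS
alt⁺ (suc s) = rowS ⊛ alt⁻ s
alt⁻ s       = colS ⊛ alt⁺ s

const-alt⁺ : ∀ s → const (alt⁺ s) ≡ 1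
const-alt⁺ zero    = refl
const-alt⁺ (suc s) = trans (+-identityʳ _) (trans (+-identityʳ _) (const-alt⁺ s))

coeff-alt-[] : ∀ s → coeff (alt⁺ s) [] ≡ waysBelow (suc (double s)) []
                   × coeff (alt⁻ s) [] ≡ waysBelow (suc (suc (double s))) []
coeff-alt-[] s = even s , odd′ s
  where
  even : ∀ s → coeff (alt⁺ s) [] ≡ waysBelow (suc (double s)) []
  odd′ : ∀ s → coeff (alt⁻ s) [] ≡ waysBelow (suc (suc (double s))) []
  even zero    = refl
  even (suc s) = cong₂ _+_ (trans (+-identityʳ _) (odd′ s)) (trans (+-identityʳ _) (trans (+-identityʳ _) (const-alt⁺ s)))
  odd′ s       = cong₂ _+_ (trans (+-identityʳ _) (even s)) (trans (+-identityʳ _) (const-alt⁺ s))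

coeff-alt-∷ : ∀ x w → (∀ s → coeff (alt⁺ s) w ≡ waysBelow (suc (double s)) w) →
                      (∀ s → coeff (alt⁻ s) w ≡ waysBelow (suc (suc (double s))) w) →
              ∀ s → coeff (alt⁺ s) (x ∷ w) ≡ waysBelow (suc (double s)) (x ∷ w)
                  × coeff (alt⁻ s) (x ∷ w) ≡ waysBelow (suc (suc (double s))) (x ∷ w)
coeff-alt-∷ asc w ih⁺ ih⁻ zero = even , cong₂ _+_ (trans (+-identityʳ _) even)
  (trans (prodCoeff-oneˡ (alt⁺ 0) w) (trans (ih⁺ 0) (sym (+-identityʳ _))))
  where
  even : coeff (alt⁺ 0) (asc ∷ w) ≡ waysBelow 1 (asc ∷ w)
  even = cong (0 +_) (ih⁺ 0)
coeff-alt-∷ des w ih⁺ ih⁻ zero = even , cong₂ _+_ (trans (+-identityʳ _) even) (ih⁻ 0)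
  where
  even : coeff (alt⁺ 0) (des ∷ w) ≡ waysBelow 1 (des ∷ w)
  even = prodCoeff-oneˡ oneS w
coeff-alt-∷ asc w ih⁺ ih⁻ (suc s) = even , cong₂ _+_ (trans (+-identityʳ _) even)
  (trans (prodCoeff-oneˡ (alt⁺ (suc s)) w) (trans (ih⁺ (suc s))
    (trans (sym (+-identityʳ _)) (sym (stepA-odd (λ r → ways r w) (suc (double (suc s))) (odd-suc-double (suc s)))))))
  where
  even : coeff (alt⁺ (suc s)) (asc ∷ w) ≡ waysBelow (suc (double (suc s))) (asc ∷ w)
  even = cong₂ _+_ (trans (+-identityʳ _) (proj₂ (coeff-alt-∷ asc w ih⁺ ih⁻ s)))
           (trans (ih⁺ (suc s)) (sym (stepA-even (λ r → ways r w) (double (suc s)) (odd-double (suc s)))))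
coeff-alt-∷ des w ih⁺ ih⁻ (suc s) = even , cong₂ _+_ (trans (+-identityʳ _) even)
  (trans (ih⁻ (suc s)) (sym (stepD-odd (λ r → ways r w) (suc (double (suc s))) (odd-suc-double (suc s)))))
  where
  even : coeff (alt⁺ (suc s)) (des ∷ w) ≡ waysBelow (suc (double (suc s))) (des ∷ w)
  even = cong₂ _+_ (trans (+-identityʳ _) (proj₂ (coeff-alt-∷ des w ih⁺ ih⁻ s)))
           (trans (prodCoeff-oneˡ (alt⁻ s) w) (trans (ih⁻ s)
             (trans (sym (+-identityʳ _)) (sym (stepD-even (λ r → ways r w) (double (suc s)) (odd-double (suc s)))))))

coeff-alt : ∀ w s → coeff (alt⁺ s) w ≡ waysBelow (suc (double s)) w
                  × coeff (alt⁻ s) w ≡ waysBelow (suc (suc (double s))) w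
coeff-alt []      = coeff-alt-[]
coeff-alt (x ∷ w) = coeff-alt-∷ x w (λ s → proj₁ (coeff-alt w s)) (λ s → proj₂ (coeff-alt w s))

[col⊛row]^ : ℕ → WordSeries
[col⊛row]^ zero    = oneS
[col⊛row]^ (suc k) = (colS ⊛ rowS) ⊛ [col⊛row]^ k

row⊛[col⊛row]^≐alt⁺ : ∀ k → rowS ⊛ [col⊛row]^ k ≐ alt⁺ k
row⊛[col⊛row]^≐alt⁺ zero    = ≐-refl
row⊛[col⊛row]^≐alt⁺ (suc k) =
  ⊛-cong {rowS} ≐-refl (≐-trans (⊛-assoc colS rowS ([col⊛row]^ k)) (⊛-cong {colS} ≐-refl (row⊛[col⊛row]^≐alt⁺ k)))

coeff-row⊛[col⊛row]^ : ∀ k w → coeff (rowS ⊛ [col⊛row]^ k) w ≡ vWord k w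
coeff-row⊛[col⊛row]^ k w = trans (proj₂ (row⊛[col⊛row]^≐alt⁺ k) w) (proj₁ (coeff-alt w k))

sumMap : {X : Set} → (X → ℕ) → List X → ℕ
sumMap f []       = 0
sumMap f (x ∷ xs) = f x + sumMap f xs

sumMap-++ : {X : Set} (f : X → ℕ) (xs ys : List X) → sumMap f (xs ++ ys) ≡ sumMap f xs + sumMap f ys
sumMap-++ f []       ys = refl
sumMap-++ f (x ∷ xs) ys = trans (cong (f x +_) (sumMap-++ f xs ys)) (sym (+-assoc (f x) _ _))

sumMap-concatMap : {X Y : Set} (f : Y → ℕ) (h : X → List Y) (xs : List X) →
  sumMap f (concatMap h xs) ≡ sumMap (λ x → sumMap f (h x)) xs
sumMap-concatMap f h []       = refl
sumMap-concatMap f h (x ∷ xs) =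
  trans (sumMap-++ f (h x) (concatMap h xs)) (cong (sumMap f (h x) +_) (sumMap-concatMap f h xs))

sumMap-cong-All : {X : Set} {P : X → Set} {f g : X → ℕ} {xs : List X} →
  All P xs → (∀ x → P x → f x ≡ g x) → sumMap f xs ≡ sumMap g xs
sumMap-cong-All []       e = refl
sumMap-cong-All (p ∷ ps) e = cong₂ _+_ (e _ p) (sumMap-cong-All ps e)

sumMap-cong : {X : Set} {f g : X → ℕ} → (∀ x → f x ≡ g x) → ∀ xs → sumMap f xs ≡ sumMap g xs
sumMap-cong e []       = refl
sumMap-cong e (x ∷ xs) = cong₂ _+_ (e x) (sumMap-cong e xs)

sumMap-*ˡ : {X : Set} (k : ℕ) (g : X → ℕ) (xs : List X) → sumMap (λ x → k * g x) xs ≡ k * sumMap g xs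
sumMap-*ˡ k g []       = sym (*-zeroʳ k)
sumMap-*ˡ k g (x ∷ xs) = trans (cong (k * g x +_) (sumMap-*ˡ k g xs)) (sym (*-distribˡ-+ k (g x) _))

sumMap-*ʳ : {X : Set} (f : X → ℕ) (k : ℕ) (xs : List X) → sumMap (λ x → f x * k) xs ≡ sumMap f xs * k
sumMap-*ʳ f k []       = refl
sumMap-*ʳ f k (x ∷ xs) = trans (cong (f x * k +_) (sumMap-*ʳ f k xs)) (sym (*-distribʳ-+ k (f x) (sumMap f xs)))

sumMap-* : {X Y : Set} (f : X → ℕ) (g : Y → ℕ) (xs : List X) (ys : List Y) →
  sumMap (λ x → sumMap (λ y → f x * g y) ys) xs ≡ sumMap f xs * sumMap g ys
sumMap-* f g xs ys =
  trans (sumMap-cong (λ x → sumMap-*ˡ (f x) g ys) xs) (sumMap-*ʳ f (sumMap g ys) xs)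

compWord : Comp → Word
compWord []          = []
compWord (i ∷ [])    = replicate (i ∸ 1) asc
compWord (i ∷ j ∷ r) = replicate (i ∸ 1) asc ++ des ∷ compWord (j ∷ r)

bitEq : Bool → Bool → Bool
bitEq true  true  = true
bitEq false false = true
bitEq true  false = false
bitEq false true  = false

wordEq : Word → Word → Bool
wordEq []      []      = true
wordEq []      (_ ∷ _) = false
wordEq (_ ∷ _) []      = false
wordEq (x ∷ u) (y ∷ v) = bitEq x y ∧ wordEq u v

𝟙 : Bool → ℕ
𝟙 true  = 1
𝟙 false = 0

𝟙-∧ : ∀ b c → 𝟙 (b ∧ c) ≡ 𝟙 b * 𝟙 c
𝟙-∧ true  c = sym (+-identityʳ (𝟙 c))
𝟙-∧ false c = refl

𝟙-wordEq-cut : ∀ u v w → length u < length w →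
  𝟙 (wordEq (u ++ des ∷ v) w) + 𝟙 (wordEq (u ++ asc ∷ v) w)
    ≡ 𝟙 (wordEq u (take (length u) w)) * 𝟙 (wordEq v (drop (suc (length u)) w))
𝟙-wordEq-cut []      v (des ∷ w) _ = refl
𝟙-wordEq-cut []      v (asc ∷ w) _ = sym (+-identityʳ _)
𝟙-wordEq-cut (z ∷ u) v (y ∷ w) (s≤s lt) = begin
    𝟙 (e ∧ wordEq (u ++ des ∷ v) w) + 𝟙 (e ∧ wordEq (u ++ asc ∷ v) w)
  ≡⟨ cong₂ _+_ (𝟙-∧ e _) (𝟙-∧ e _) ⟩
    𝟙 e * 𝟙 (wordEq (u ++ des ∷ v) w) + 𝟙 e * 𝟙 (wordEq (u ++ asc ∷ v) w)
  ≡⟨ sym (*-distribˡ-+ (𝟙 e) _ _) ⟩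
    𝟙 e * (𝟙 (wordEq (u ++ des ∷ v) w) + 𝟙 (wordEq (u ++ asc ∷ v) w))
  ≡⟨ cong (𝟙 e *_) (𝟙-wordEq-cut u v w lt) ⟩
    𝟙 e * (𝟙 (wordEq u (take (length u) w)) * rest)
  ≡⟨ sym (*-assoc (𝟙 e) _ _) ⟩
    (𝟙 e * 𝟙 (wordEq u (take (length u) w))) * rest
  ≡⟨ cong (_* rest) (sym (𝟙-∧ e _)) ⟩
    𝟙 (e ∧ wordEq u (take (length u) w)) * rest ∎
  where
  open ≡-Reasoning
  e = bitEq z y
  rest = 𝟙 (wordEq v (drop (suc (length u)) w))

AllPositive : Comp → Set
AllPositive = All (1 ≤_)

sumParts : Comp → ℕ
sumParts []      = 0
sumParts (i ∷ I) = i + sumParts I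

IsCompOf : ℕ → Comp → Set
IsCompOf d I = AllPositive I × sumParts I ≡ d

compOf0⇒[] : ∀ {I} → IsCompOf 0 I → I ≡ []
compOf0⇒[] {[]}        _              = refl
compOf0⇒[] {zero ∷ I}  ((() ∷ _) , _)
compOf0⇒[] {suc i ∷ I} (_ , ())

sumParts-++ : ∀ I J → sumParts (I ++ J) ≡ sumParts I + sumParts J
sumParts-++ []      J = refl
sumParts-++ (i ∷ I) J = trans (cong (i +_) (sumParts-++ I J)) (sym (+-assoc i _ _))

lastMerge-positive : ∀ i I j J → AllPositive (i ∷ I) → AllPositive (j ∷ J) →
  AllPositive (lastMerge (i ∷ I) (j ∷ J)) × sumParts (lastMerge (i ∷ I) (j ∷ J)) ≡ sumParts (i ∷ I) + sumParts (j ∷ J)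
lastMerge-positive i [] j J (p ∷ _) (q ∷ qs) =
  (≤-trans p (m≤m+n i j) ∷ qs) ,
  solve 3 (λ i j s → (i :+ j) :+ s := (i :+ con 0) :+ (j :+ s)) refl i j (sumParts J)
lastMerge-positive i (i′ ∷ I) j J (p ∷ ps) q with lastMerge-positive i′ I j J ps q
... | pp , ss = (p ∷ pp) , trans (cong (i +_) ss) (sym (+-assoc i _ _))

ribbonTerms : Comp → Comp → List Comp
ribbonTerms I J = map proj₂ (ribbonProd I J)

ribbonTerms-IsCompOf : ∀ a d I J → a ≤ d → IsCompOf a I → IsCompOf (d ∸ a) J → All (IsCompOf d) (ribbonTerms I J)
ribbonTerms-IsCompOf .0 d [] J a≤d (_ , refl) pJ = pJ ∷ []
ribbonTerms-IsCompOf a d (i ∷ I) [] a≤d pI (_ , e) =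
  subst (λ z → IsCompOf z (i ∷ I)) (≤-antisym a≤d (m∸n≡0⇒m≤n (sym e))) pI ∷ []
ribbonTerms-IsCompOf a d (i ∷ I) (j ∷ J) a≤d (pI , sI) (pJ , sJ) =
  (++⁺ pI pJ , trans (sumParts-++ (i ∷ I) (j ∷ J)) total) ∷ (proj₁ merged , trans (proj₂ merged) total) ∷ []
  where
  merged = lastMerge-positive i I j J pI pJ
  total = trans (cong₂ _+_ sI sJ) (m+[n∸m]≡n a≤d)

replicate-asc-split : ∀ i j → 1 ≤ i → 1 ≤ j →
  replicate (i + j ∸ 1) asc ≡ replicate (i ∸ 1) asc ++ asc ∷ replicate (j ∸ 1) asc
replicate-asc-split (suc zero)    (suc j) _ _ = refl
replicate-asc-split (suc (suc i)) j       _ q = cong (asc ∷_) (replicate-asc-split (suc i) j (s≤s z≤n) q)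

compWord-++ : ∀ i I j J → AllPositive (i ∷ I) → compWord ((i ∷ I) ++ (j ∷ J)) ≡ compWord (i ∷ I) ++ des ∷ compWord (j ∷ J)
compWord-++ i []        j J _ = refl
compWord-++ i (i′ ∷ I) j J (_ ∷ p) =
  trans (cong (λ z → replicate (i ∸ 1) asc ++ des ∷ z) (compWord-++ i′ I j J p))
        (sym (++-assoc (replicate (i ∸ 1) asc) (des ∷ compWord (i′ ∷ I)) _))

compWord-lastMerge : ∀ i I j J → AllPositive (i ∷ I) → AllPositive (j ∷ J) →
  compWord (lastMerge (i ∷ I) (j ∷ J)) ≡ compWord (i ∷ I) ++ asc ∷ compWord (j ∷ J)
compWord-lastMerge i [] j [] (p ∷ _) (q ∷ _) = replicate-asc-split i j p q
compWord-lastMerge i [] j (j′ ∷ J) (p ∷ _) (q ∷ _) =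
  trans (cong (_++ des ∷ compWord (j′ ∷ J)) (replicate-asc-split i j p q))
        (++-assoc (replicate (i ∸ 1) asc) (asc ∷ replicate (j ∸ 1) asc) _)
compWord-lastMerge i (i′ ∷ []) j J (_ ∷ p) q =
  trans (cong (λ z → replicate (i ∸ 1) asc ++ des ∷ z) (compWord-lastMerge i′ [] j J p q))
        (sym (++-assoc (replicate (i ∸ 1) asc) (des ∷ compWord (i′ ∷ [])) _))
compWord-lastMerge i (i′ ∷ i″ ∷ I) j J (_ ∷ p) q =
  trans (cong (λ z → replicate (i ∸ 1) asc ++ des ∷ z) (compWord-lastMerge i′ (i″ ∷ I) j J p q))
        (sym (++-assoc (replicate (i ∸ 1) asc) (des ∷ compWord (i′ ∷ i″ ∷ I)) _))

suc-length-compWord : ∀ i I → AllPositive (i ∷ I) → suc (length (compWord (i ∷ I))) ≡ sumParts (i ∷ I)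
suc-length-compWord zero    I       (() ∷ _)
suc-length-compWord (suc i) []      _ = trans (cong suc (length-replicate i)) (sym (+-identityʳ (suc i)))
suc-length-compWord (suc i) (j ∷ J) (_ ∷ p) = begin
    suc (length (replicate i asc ++ des ∷ compWord (j ∷ J)))
  ≡⟨ cong suc (length-++ (replicate i asc)) ⟩
    suc (length (replicate i asc) + suc (length (compWord (j ∷ J))))
  ≡⟨ cong₂ (λ a b → suc (a + b)) (length-replicate i) (suc-length-compWord j J p) ⟩
    suc (i + sumParts (j ∷ J)) ∎
  where open ≡-Reasoning

length-compWord : ∀ a I → IsCompOf (suc a) I → length (compWord I) ≡ a
length-compWord a []      (_ , ())
length-compWord a (i ∷ I) (p , s) = suc-injective (trans (suc-length-compWord i I p) s)

-- Series all of whose coefficients are 1, listed degreewise by their compositions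

CompSeries : Set
CompSeries = ℕ → List Comp

prodTerms : List Comp → List Comp → List Comp
prodTerms X Y = concatMap (λ I → concatMap (λ J → ribbonTerms I J) Y) X

infixl 7 _⋆ᶜ_
_⋆ᶜ_ : CompSeries → CompSeries → CompSeries
(A ⋆ᶜ B) d = concatMap (λ a → prodTerms (A a) (B (d ∸ a))) (upTo (suc d))

IsCompSeries : CompSeries → Set
IsCompSeries A = ∀ d → All (IsCompOf d) (A d)

All-concatMap : {X Y : Set} {P : Y → Set} {h : X → List Y} {xs : List X} →
  All (λ x → All P (h x)) xs → All P (concatMap h xs)
All-concatMap ps = concat⁺ (map⁺ ps)

IsCompSeries-⋆ᶜ : ∀ {A B} → IsCompSeries A → IsCompSeries B → IsCompSeries (A ⋆ᶜ B)
IsCompSeries-⋆ᶜ {A} {B} iA iB d = All-concatMap (applyUpTo⁺₁ _ (suc d) (λ {a} a<1+d → atCut a (≤-pred a<1+d)))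
  where
  atCut : ∀ a → a ≤ d → All (IsCompOf d) (prodTerms (A a) (B (d ∸ a)))
  atCut a a≤d = All-concatMap (All.map (λ pI → All-concatMap (All.map (λ pJ →
    ribbonTerms-IsCompOf a d _ _ a≤d pI pJ) (iB (d ∸ a)))) (iA a))

countWord : Word → List Comp → ℕ
countWord w = sumMap (λ I → 𝟙 (wordEq (compWord I) w))

wordSeriesOf : CompSeries → WordSeries
wordSeriesOf A = wordSeries (length (A 0)) (λ u → countWord u (A (suc (length u))))

countWord-prodTerms-first : ∀ w X Y → All (IsCompOf 0) X → countWord w (prodTerms X Y) ≡ length X * countWord w Y
countWord-prodTerms-first w X Y pX =
  trans (sumMap-concatMap _ (λ I → concatMap (ribbonTerms I) Y) X)
    (trans (sumMap-cong-All pX (λ I p → unitˡ I (compOf0⇒[] p))) (sumMap-const (countWord w Y) X))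
  where
  sumMap-const : {X : Set} (k : ℕ) (xs : List X) → sumMap (λ _ → k) xs ≡ length xs * k
  sumMap-const k []       = refl
  sumMap-const k (x ∷ xs) = cong (k +_) (sumMap-const k xs)
  unitˡ : ∀ I → I ≡ [] → countWord w (concatMap (ribbonTerms I) Y) ≡ countWord w Y
  unitˡ .[] refl = trans (sumMap-concatMap _ (λ J → J ∷ []) Y) (sumMap-cong (λ J → +-identityʳ _) Y)

countWord-prodTerms-last : ∀ w m X Y → All (IsCompOf (suc m)) X → All (IsCompOf 0) Y →
  countWord w (prodTerms X Y) ≡ countWord w X * length Y
countWord-prodTerms-last w m X Y pX pY =
  trans (sumMap-concatMap _ (λ I → concatMap (ribbonTerms I) Y) X)
    (trans (sumMap-cong-All pX (λ I p → unitʳ I p Y pY)) (sumMap-*ʳ (λ I → 𝟙 (wordEq (compWord I) w)) (length Y) X))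
  where
  unitʳ : ∀ I → IsCompOf (suc m) I → ∀ Y → All (IsCompOf 0) Y →
    countWord w (concatMap (ribbonTerms I) Y) ≡ 𝟙 (wordEq (compWord I) w) * length Y
  unitʳ []      (_ , ()) Y pY
  unitʳ (i ∷ I) p []       []       = sym (*-zeroʳ (𝟙 (wordEq (compWord (i ∷ I)) w)))
  unitʳ (i ∷ I) p ([] ∷ Ys) (_ ∷ ps) =
    trans (cong (𝟙 (wordEq (compWord (i ∷ I)) w) +_) (unitʳ (i ∷ I) p Ys ps))
          (sym (*-suc (𝟙 (wordEq (compWord (i ∷ I)) w)) (length Ys)))
  unitʳ (i ∷ I) p ((j ∷ J) ∷ Ys) (q ∷ ps) with compOf0⇒[] q
  ... | ()

countWord-ribbonTerms-cut : ∀ w a m I J → a < length w → IsCompOf (suc a) I → IsCompOf (suc m) J →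
  countWord w (ribbonTerms I J) ≡ 𝟙 (wordEq (compWord I) (take a w)) * 𝟙 (wordEq (compWord J) (drop (suc a) w))
countWord-ribbonTerms-cut w a m []      J       a<w (_ , ()) q
countWord-ribbonTerms-cut w a m (i ∷ I) []      a<w p (_ , ())
countWord-ribbonTerms-cut w a m (i ∷ I) (j ∷ J) a<w (pI , sI) (pJ , sJ) = begin
    𝟙 (wordEq (compWord ((i ∷ I) ++ (j ∷ J))) w) + (𝟙 (wordEq (compWord (lastMerge (i ∷ I) (j ∷ J))) w) + 0)
  ≡⟨ cong₂ (λ x y → 𝟙 (wordEq x w) + y) (compWord-++ i I j J pI)
       (trans (+-identityʳ _) (cong (λ x → 𝟙 (wordEq x w)) (compWord-lastMerge i I j J pI pJ))) ⟩
    𝟙 (wordEq (u ++ des ∷ v) w) + 𝟙 (wordEq (u ++ asc ∷ v) w)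
  ≡⟨ 𝟙-wordEq-cut u v w (subst (_< length w) (sym |u|≡a) a<w) ⟩
    𝟙 (wordEq u (take (length u) w)) * 𝟙 (wordEq v (drop (suc (length u)) w))
  ≡⟨ cong (λ z → 𝟙 (wordEq u (take z w)) * 𝟙 (wordEq v (drop (suc z) w))) |u|≡a ⟩
    𝟙 (wordEq u (take a w)) * 𝟙 (wordEq v (drop (suc a) w)) ∎
  where
  open ≡-Reasoning
  u = compWord (i ∷ I)
  v = compWord (j ∷ J)
  |u|≡a = length-compWord a (i ∷ I) (pI , sI)

countWord-prodTerms-cut : ∀ w a m X Y → a < length w → All (IsCompOf (suc a)) X → All (IsCompOf (suc m)) Y →
  countWord w (prodTerms X Y) ≡ countWord (take a w) X * countWord (drop (suc a) w) Y
countWord-prodTerms-cut w a m X Y a<w pX pY =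
  trans (sumMap-concatMap _ (λ I → concatMap (ribbonTerms I) Y) X)
    (trans (sumMap-cong-All pX (λ I p → trans (sumMap-concatMap _ (ribbonTerms I) Y)
                                          (sumMap-cong-All pY (λ J q → countWord-ribbonTerms-cut w a m I J a<w p q))))
      (sumMap-* (λ I → 𝟙 (wordEq (compWord I) (take a w))) (λ J → 𝟙 (wordEq (compWord J) (drop (suc a) w))) X Y))

cutTerm : WordSeries → WordSeries → Word → ℕ → ℕ
cutTerm f g w       zero    = const f * coeff g w
cutTerm f g []      (suc a) = coeff f [] * const g
cutTerm f g (x ∷ w) (suc a) = cutTerm (∂ x f) g w a

cutTerm-middle : ∀ f g w a → a < length w → cutTerm f g w (suc a) ≡ coeff f (take a w) * coeff g (drop (suc a) w)
cutTerm-middle f g (x ∷ w) zero    _        = refl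
cutTerm-middle f g (x ∷ w) (suc a) (s≤s lt) = cutTerm-middle (∂ x f) g w a lt

cutTerm-last : ∀ f g w → cutTerm f g w (suc (length w)) ≡ coeff f w * const g
cutTerm-last f g []      = refl
cutTerm-last f g (x ∷ w) = cutTerm-last (∂ x f) g w

sumFirst : (ℕ → ℕ) → ℕ → ℕ
sumFirst h zero    = 0
sumFirst h (suc n) = h 0 + sumFirst (λ a → h (suc a)) n

sumFirst-cong : ∀ {h h′} n → (∀ a → a < n → h a ≡ h′ a) → sumFirst h n ≡ sumFirst h′ n
sumFirst-cong zero    e = refl
sumFirst-cong (suc n) e = cong₂ _+_ (e 0 (s≤s z≤n)) (sumFirst-cong n (λ a lt → e (suc a) (s≤s lt)))

sumFirst-cutTerm : ∀ f g w → sumFirst (cutTerm f g w) (suc (suc (length w))) ≡ prodCoeff f g w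
sumFirst-cutTerm f g []      = cong (const f * coeff g [] +_) (+-identityʳ _)
sumFirst-cutTerm f g (x ∷ w) = cong (const f * coeff g (x ∷ w) +_) (sumFirst-cutTerm (∂ x f) g w)

sumMap-applyUpTo : (f g : ℕ → ℕ) (n : ℕ) → sumMap f (applyUpTo g n) ≡ sumFirst (λ a → f (g a)) n
sumMap-applyUpTo f g zero    = refl
sumMap-applyUpTo f g (suc n) = cong (f (g 0) +_) (sumMap-applyUpTo f (λ a → g (suc a)) n)

countWord-prodTerms≡cutTerm : ∀ {A B} → IsCompSeries A → IsCompSeries B → ∀ w a → a ≤ suc (length w) →
  countWord w (prodTerms (A a) (B (suc (length w) ∸ a))) ≡ cutTerm (wordSeriesOf A) (wordSeriesOf B) w a
countWord-prodTerms≡cutTerm {A} {B} iA iB w zero    _ = countWord-prodTerms-first w (A 0) (B (suc (length w))) (iA 0)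
countWord-prodTerms≡cutTerm {A} {B} iA iB w (suc a) a<1+w with m≤n⇒m<n∨m≡n (≤-pred a<1+w)
... | inj₁ a<w =
  trans (countWord-prodTerms-cut w a (length (drop (suc a) w)) (A (suc a)) (B (length w ∸ a)) a<w (iA (suc a))
          (subst (λ z → All (IsCompOf z) (B (length w ∸ a))) (sym |drop|) (iB (length w ∸ a))))
    (trans (cong₂ (λ x y → countWord (take a w) (A (suc x)) * countWord (drop (suc a) w) (B y)) (sym |take|) (sym |drop|))
           (sym (cutTerm-middle (wordSeriesOf A) (wordSeriesOf B) w a a<w)))
  where
  |take| : length (take a w) ≡ a
  |take| = trans (length-take a w) (m≤n⇒m⊓n≡m (<⇒≤ a<w))
  |drop| : suc (length (drop (suc a) w)) ≡ length w ∸ a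
  |drop| = trans (cong suc (length-drop (suc a) w)) (sym (+-∸-assoc 1 a<w))
... | inj₂ refl =
  trans (cong (λ z → countWord w (prodTerms (A (suc m)) (B z))) (n∸n≡0 m))

    (trans (countWord-prodTerms-last w m (A (suc m)) (B 0) (iA (suc m)) (iB 0))
           (sym (cutTerm-last (wordSeriesOf A) (wordSeriesOf B) w)))
  where m = length w

wordSeriesOf-⋆ᶜ : ∀ {A B} → IsCompSeries A → IsCompSeries B → wordSeriesOf (A ⋆ᶜ B) ≐ wordSeriesOf A ⊛ wordSeriesOf B
wordSeriesOf-⋆ᶜ {A} {B} iA iB = constTerm , λ w →
  trans (sumMap-concatMap _ (λ a → prodTerms (A a) (B (suc (length w) ∸ a))) (upTo (suc (suc (length w)))))
    (trans (sumMap-applyUpTo (λ a → countWord w (prodTerms (A a) (B (suc (length w) ∸ a)))) (λ a → a) (suc (suc (length w))))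
      (trans (sumFirst-cong (suc (suc (length w))) (λ a a<2+w → countWord-prodTerms≡cutTerm iA iB w a (≤-pred a<2+w)))
             (sumFirst-cutTerm (wordSeriesOf A) (wordSeriesOf B) w)))
  where
  length-prodTerms-[] : ∀ X Y → All (IsCompOf 0) X → length (prodTerms X Y) ≡ length X * length Y
  length-prodTerms-[] []      Y _ = refl
  length-prodTerms-[] (I ∷ X) Y (p ∷ ps) with compOf0⇒[] p
  ... | refl = trans (length-++ (concatMap (λ J → J ∷ []) Y)) (cong₂ _+_ (singletons Y) (length-prodTerms-[] X Y ps))
    where
    singletons : ∀ (Y : List Comp) → length (concatMap (λ J → J ∷ []) Y) ≡ length Y
    singletons []      = refl
    singletons (J ∷ Y) = cong suc (singletons Y)
  constTerm : length (prodTerms (A 0) (B 0) ++ []) ≡ length (A 0) * length (B 0)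
  constTerm = trans (cong length (++-identityʳ (prodTerms (A 0) (B 0)))) (length-prodTerms-[] (A 0) (B 0) (iA 0))

rowᶜ colᶜ oneᶜ : CompSeries
rowᶜ zero    = [] ∷ []
rowᶜ (suc i) = (suc i ∷ []) ∷ []
colᶜ i       = replicate i 1 ∷ []
oneᶜ zero    = [] ∷ []
oneᶜ (suc _) = []

_^ᶜ_ : CompSeries → ℕ → CompSeries
X ^ᶜ zero  = oneᶜ
X ^ᶜ suc k = X ⋆ᶜ (X ^ᶜ k)

Vᶜ : ℕ → CompSeries
Vᶜ k = rowᶜ ⋆ᶜ ((colᶜ ⋆ᶜ rowᶜ) ^ᶜ k)

IsCompSeries-rowᶜ : IsCompSeries rowᶜ
IsCompSeries-rowᶜ zero    = ([] , refl) ∷ []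
IsCompSeries-rowᶜ (suc i) = ((s≤s z≤n ∷ []) , +-identityʳ _) ∷ []

IsCompSeries-colᶜ : IsCompSeries colᶜ
IsCompSeries-colᶜ i = ones i ∷ []
  where
  ones : ∀ i → IsCompOf i (replicate i 1)
  ones zero    = [] , refl
  ones (suc i) = (s≤s z≤n ∷ proj₁ (ones i)) , cong suc (proj₂ (ones i))

IsCompSeries-oneᶜ : IsCompSeries oneᶜ
IsCompSeries-oneᶜ zero    = ([] , refl) ∷ []
IsCompSeries-oneᶜ (suc _) = []

IsCompSeries-^ᶜ : ∀ {X} → IsCompSeries X → ∀ k → IsCompSeries (X ^ᶜ k)
IsCompSeries-^ᶜ iX zero    = IsCompSeries-oneᶜ
IsCompSeries-^ᶜ iX (suc k) = IsCompSeries-⋆ᶜ iX (IsCompSeries-^ᶜ iX k)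

IsCompSeries-col⋆row : IsCompSeries (colᶜ ⋆ᶜ rowᶜ)
IsCompSeries-col⋆row = IsCompSeries-⋆ᶜ IsCompSeries-colᶜ IsCompSeries-rowᶜ

IsCompSeries-Vᶜ : ∀ k → IsCompSeries (Vᶜ k)
IsCompSeries-Vᶜ k = IsCompSeries-⋆ᶜ IsCompSeries-rowᶜ (IsCompSeries-^ᶜ IsCompSeries-col⋆row k)

wordSeriesOf-rowᶜ : wordSeriesOf rowᶜ ≐ rowS
wordSeriesOf-rowᶜ = refl , λ u → trans (+-identityʳ _) (ascs u)
  where
  ascs : ∀ u → 𝟙 (wordEq (replicate (length u) asc) u) ≡ allAsc u
  ascs []        = refl
  ascs (asc ∷ u) = ascs u
  ascs (des ∷ u) = refl

wordSeriesOf-colᶜ : wordSeriesOf colᶜ ≐ colS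
wordSeriesOf-colᶜ = refl , λ u → trans (+-identityʳ _) (trans (cong (λ z → 𝟙 (wordEq z u)) (compWord-ones (length u))) (dess u))
  where
  compWord-ones : ∀ n → compWord (replicate (suc n) 1) ≡ replicate n des
  compWord-ones zero    = refl
  compWord-ones (suc n) = cong (des ∷_) (compWord-ones n)
  dess : ∀ u → 𝟙 (wordEq (replicate (length u) des) u) ≡ allDes u
  dess []        = refl
  dess (des ∷ u) = dess u
  dess (asc ∷ u) = refl

wordSeriesOf-[col⋆row]^ᶜ : ∀ k → wordSeriesOf ((colᶜ ⋆ᶜ rowᶜ) ^ᶜ k) ≐ [col⊛row]^ k
wordSeriesOf-[col⋆row]^ᶜ zero    = ≐-refl
wordSeriesOf-[col⋆row]^ᶜ (suc k) =
  ≐-trans (wordSeriesOf-⋆ᶜ IsCompSeries-col⋆row (IsCompSeries-^ᶜ IsCompSeries-col⋆row k))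
    (⊛-cong (≐-trans (wordSeriesOf-⋆ᶜ IsCompSeries-colᶜ IsCompSeries-rowᶜ) (⊛-cong wordSeriesOf-colᶜ wordSeriesOf-rowᶜ))
            (wordSeriesOf-[col⋆row]^ᶜ k))

countWord-Vᶜ : ∀ k w → countWord w (Vᶜ k (suc (length w))) ≡ vWord k w
countWord-Vᶜ k w =
  trans (proj₂ (≐-trans (wordSeriesOf-⋆ᶜ IsCompSeries-rowᶜ (IsCompSeries-^ᶜ IsCompSeries-col⋆row k))
                        (⊛-cong wordSeriesOf-rowᶜ (wordSeriesOf-[col⋆row]^ᶜ k))) w)
        (coeff-row⊛[col⊛row]^ k w)

-- The series of Defs have all coefficients 1

unitCoeffs : List Comp → Elem
unitCoeffs = map (1ℚ ,_)

scaled-ribbonProd : ∀ I J → map (λ { (c , K) → (1ℚ *ℚ 1ℚ *ℚ c , K) }) (ribbonProd I J) ≡ unitCoeffs (ribbonTerms I J)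
scaled-ribbonProd []      J       = refl
scaled-ribbonProd (i ∷ I) []      = refl
scaled-ribbonProd (i ∷ I) (j ∷ J) = refl

prodE-unitCoeffs : ∀ X Y → prodE (unitCoeffs X) (unitCoeffs Y) ≡ unitCoeffs (prodTerms X Y)
prodE-unitCoeffs []      Y = refl
prodE-unitCoeffs (I ∷ X) Y =
  trans (cong₂ _++_ (trans (sym (++-identityʳ _)) (row Y)) (prodE-unitCoeffs X Y)) (sym (map-++ (1ℚ ,_) (concatMap (ribbonTerms I) Y) _))
  where
  row : ∀ Y → prodE (unitCoeffs (I ∷ [])) (unitCoeffs Y) ≡ unitCoeffs (concatMap (ribbonTerms I) Y)
  row []      = refl
  row (J ∷ Y) = trans (++-assoc (map _ (ribbonProd I J)) _ [])
    (trans (cong₂ _++_ (scaled-ribbonProd I J) (row Y)) (sym (map-++ (1ℚ ,_) (ribbonTerms I J) _)))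

⋆-unitCoeffs : ∀ {X Y A B} → (∀ d → X d ≡ unitCoeffs (A d)) → (∀ d → Y d ≡ unitCoeffs (B d)) →
  ∀ d → (X ⋆ Y) d ≡ unitCoeffs ((A ⋆ᶜ B) d)
⋆-unitCoeffs {A = A} {B} eX eY d =
  trans (concatMap-cong (λ a → trans (cong₂ prodE (eX a) (eY (d ∸ a))) (prodE-unitCoeffs (A a) (B (d ∸ a)))) (upTo (suc d)))
        (sym (map-concatMap (1ℚ ,_) _ (upTo (suc d))))

V1plus≡ : ∀ d → V1plus d ≡ unitCoeffs (rowᶜ d)
V1plus≡ zero    = refl
V1plus≡ (suc d) = refl

unitS≡ : ∀ d → unitS d ≡ unitCoeffs (oneᶜ d)
unitS≡ zero    = refl
unitS≡ (suc d) = refl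

^⋆-unitCoeffs : ∀ {X A} → (∀ d → X d ≡ unitCoeffs (A d)) → ∀ k d → (X ^⋆ k) d ≡ unitCoeffs ((A ^ᶜ k) d)
^⋆-unitCoeffs e zero    = unitS≡
^⋆-unitCoeffs e (suc k) = ⋆-unitCoeffs e (^⋆-unitCoeffs e k)

Vplus≡ : ∀ k d → Vplus k d ≡ unitCoeffs (Vᶜ k d)
Vplus≡ k = ⋆-unitCoeffs V1plus≡ (^⋆-unitCoeffs (⋆-unitCoeffs {V1minus} (λ d → refl) V1plus≡) k)

-- From ribbons to descent sets of permutations

toℚ : ℕ → ℚ
toℚ zero    = 0ℚ
toℚ (suc n) = 1ℚ +ℚ toℚ n

countDescSet : List ℕ → List Comp → ℕ
countDescSet D = sumMap (λ I → 𝟙 (does (≡-dec ℕ._≟_ (descSet I) D)))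

ev-unitCoeffs : ∀ n L (σ : Permutation′ n) → ev n (unitCoeffs L) σ ≡ toℚ (countDescSet (Des σ) L)
ev-unitCoeffs n []      σ = refl
ev-unitCoeffs n (I ∷ L) σ with does (≡-dec ℕ._≟_ (descSet I) (Des σ))
... | true  = cong (1ℚ +ℚ_) (ev-unitCoeffs n L σ)
... | false = trans (ℚ.+-identityˡ _) (ev-unitCoeffs n L σ)

select : List ℕ → Word → List ℕ
select []       _       = []
select (i ∷ is) []      = []
select (i ∷ is) (b ∷ w) = if b then i ∷ select is w else select is w

interval : ℕ → ℕ → List ℕ
interval o zero    = []
interval o (suc m) = o ∷ interval (suc o) m

length-interval : ∀ o m → length (interval o m) ≡ m
length-interval o zero    = refl
length-interval o (suc m) = cong suc (length-interval (suc o) m)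

interval-+ : ∀ o a b → interval o (a + b) ≡ interval o a ++ interval (o + a) b
interval-+ o zero    b = cong (λ z → interval z b) (sym (+-identityʳ o))
interval-+ o (suc a) b = cong (o ∷_) (trans (interval-+ (suc o) a b) (cong (λ z → interval (suc o) a ++ interval z b) (sym (+-suc o a))))

map-suc-upTo : ∀ m → map suc (upTo m) ≡ interval 1 m
map-suc-upTo m = trans (map-applyUpTo (λ i → i) suc m) (applyUpTo≡interval suc 1 (λ i → refl) m)
  where
  applyUpTo≡interval : ∀ (f : ℕ → ℕ) o → (∀ i → f i ≡ o + i) → ∀ n → applyUpTo f n ≡ interval o n
  applyUpTo≡interval f o e zero    = refl
  applyUpTo≡interval f o e (suc n) =
    cong₂ _∷_ (trans (e 0) (+-identityʳ o)) (applyUpTo≡interval (λ i → f (suc i)) (suc o) (λ i → trans (e (suc i)) (+-suc o i)) n)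

filterᵇ≡select : ∀ (p : ℕ → Bool) xs → filterᵇ p xs ≡ select xs (map p xs)
filterᵇ≡select p []       = refl
filterᵇ≡select p (x ∷ xs) with p x
... | true  = cong (x ∷_) (filterᵇ≡select p xs)
... | false = filterᵇ≡select p xs

select-++ : ∀ is js u v → length is ≡ length u → select (is ++ js) (u ++ v) ≡ select is u ++ select js v
select-++ []       js []        v _ = refl
select-++ (i ∷ is) js (des ∷ u) v e = cong (i ∷_) (select-++ is js u v (suc-injective e))
select-++ (i ∷ is) js (asc ∷ u) v e = select-++ is js u v (suc-injective e)

select-ascs : ∀ o m → select (interval o m) (replicate m asc) ≡ []
select-ascs o zero    = refl
select-ascs o (suc m) = select-ascs (suc o) m

select-compWord : ∀ b i I → AllPositive (i ∷ I) →
  select (interval (suc b) (length (compWord (i ∷ I)))) (compWord (i ∷ I)) ≡ map (b +_) (descSet (i ∷ I))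
select-compWord b i [] p =
  trans (cong (λ z → select (interval (suc b) z) (replicate (i ∸ 1) asc)) (length-replicate (i ∸ 1))) (select-ascs (suc b) (i ∸ 1))
select-compWord b (suc i) (j ∷ J) (_ ∷ p) = begin
    select (interval (suc b) (length (replicate i asc ++ des ∷ W))) (replicate i asc ++ des ∷ W)
  ≡⟨ cong (λ z → select (interval (suc b) z) (replicate i asc ++ des ∷ W))
          (trans (length-++ (replicate i asc)) (cong (_+ suc (length W)) (length-replicate i))) ⟩
    select (interval (suc b) (i + suc (length W))) (replicate i asc ++ des ∷ W)
  ≡⟨ cong (λ z → select z (replicate i asc ++ des ∷ W)) (interval-+ (suc b) i (suc (length W))) ⟩
    select (interval (suc b) i ++ interval (suc b + i) (suc (length W))) (replicate i asc ++ des ∷ W)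
  ≡⟨ select-++ (interval (suc b) i) _ (replicate i asc) (des ∷ W) (trans (length-interval (suc b) i) (sym (length-replicate i))) ⟩
    select (interval (suc b) i) (replicate i asc) ++ ((suc b + i) ∷ select (interval (suc (suc b + i)) (length W)) W)
  ≡⟨ cong₂ (λ x y → x ++ ((suc b + i) ∷ y)) (select-ascs (suc b) i) (select-compWord (suc b + i) j J p) ⟩
    (suc b + i) ∷ map (suc b + i +_) (descSet (j ∷ J))
  ≡⟨ cong₂ _∷_ (sym (+-suc b i))
       (trans (map-cong (λ x → trans (cong (_+ x) (sym (+-suc b i))) (+-assoc b (suc i) x)) (descSet (j ∷ J)))
              (map-∘ (descSet (j ∷ J)))) ⟩
    (b + suc i) ∷ map (b +_) (map (suc i +_) (descSet (j ∷ J))) ∎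
  where
  open ≡-Reasoning
  W = compWord (j ∷ J)

select-head-≥ : ∀ o m w x xs → select (interval o m) w ≡ x ∷ xs → o ≤ x
select-head-≥ o (suc m) (des ∷ u) .o ._ refl = ≤-refl
select-head-≥ o (suc m) (asc ∷ u) x xs e     = ≤-trans (n≤1+n o) (select-head-≥ (suc o) m u x xs e)

select-injective : ∀ o m w w′ → length w ≡ m → length w′ ≡ m → select (interval o m) w ≡ select (interval o m) w′ → w ≡ w′
select-injective o zero    []        []         _ _ _ = refl
select-injective o (suc m) (des ∷ u) (des ∷ u′) l l′ e =
  cong (des ∷_) (select-injective (suc o) m u u′ (suc-injective l) (suc-injective l′) (proj₂ (∷-injective e)))
select-injective o (suc m) (asc ∷ u) (asc ∷ u′) l l′ e =
  cong (asc ∷_) (select-injective (suc o) m u u′ (suc-injective l) (suc-injective l′) e)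
select-injective o (suc m) (des ∷ u) (asc ∷ u′) l l′ e = ⊥-elim (1+n≰n (select-head-≥ (suc o) m u′ o _ (sym e)))
select-injective o (suc m) (asc ∷ u) (des ∷ u′) l l′ e = ⊥-elim (1+n≰n (select-head-≥ (suc o) m u o _ e))

wordEq-refl : ∀ u → wordEq u u ≡ true
wordEq-refl []        = refl
wordEq-refl (des ∷ u) = wordEq-refl u
wordEq-refl (asc ∷ u) = wordEq-refl u

wordEq-sound : ∀ u v → wordEq u v ≡ true → u ≡ v
wordEq-sound []        []        _ = refl
wordEq-sound (des ∷ u) (des ∷ v) e = cong (des ∷_) (wordEq-sound u v e)
wordEq-sound (asc ∷ u) (asc ∷ v) e = cong (asc ∷_) (wordEq-sound u v e)

descSet≡select : ∀ m I → IsCompOf (suc m) I → descSet I ≡ select (interval 1 m) (compWord I)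
descSet≡select m [] (_ , ())
descSet≡select m (i ∷ I) c@(p , _) =
  sym (trans (cong (λ z → select (interval 1 z) (compWord (i ∷ I))) (sym (length-compWord m (i ∷ I) c)))
             (trans (select-compWord 0 i I p) (map-id (descSet (i ∷ I)))))

𝟙-descSet≡𝟙-compWord : ∀ m I w D → IsCompOf (suc m) I → length w ≡ m → D ≡ select (interval 1 m) w →
  𝟙 (does (≡-dec ℕ._≟_ (descSet I) D)) ≡ 𝟙 (wordEq (compWord I) w)
𝟙-descSet≡𝟙-compWord m I w D c |w| D≡ with ≡-dec ℕ._≟_ (descSet I) D
... | yes e = cong 𝟙 (sym (subst (λ z → wordEq (compWord I) z ≡ true) sameWord (wordEq-refl (compWord I))))
  where
  sameWord : compWord I ≡ w
  sameWord = select-injective 1 m (compWord I) w (length-compWord m I c) |w| (trans (sym (descSet≡select m I c)) (trans e D≡))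
... | no ne with wordEq (compWord I) w in eq
...   | false = refl
...   | true  = ⊥-elim (ne (trans (descSet≡select m I c) (trans (cong (select (interval 1 m)) (wordEq-sound (compWord I) w eq)) (sym D≡))))

countDescSet≡countWord : ∀ m L w D → All (IsCompOf (suc m)) L → length w ≡ m → D ≡ select (interval 1 m) w →
  countDescSet D L ≡ countWord w L
countDescSet≡countWord m L w D cL |w| D≡ = sumMap-cong-All cL (λ I c → 𝟙-descSet≡𝟙-compWord m I w D c |w| D≡)

<ᵇ-flip : ∀ a b → a ≢ b → (a <ᵇ b) ≡ not (b <ᵇ a)
<ᵇ-flip zero    zero    a≢b = ⊥-elim (a≢b refl)
<ᵇ-flip zero    (suc b) a≢b = refl
<ᵇ-flip (suc a) zero    a≢b = refl
<ᵇ-flip (suc a) (suc b) a≢b = <ᵇ-flip a b (λ e → a≢b (cong suc e))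

filterᵇ-∷ : ∀ (f : ℕ → Bool) x xs → filterᵇ f (x ∷ xs) ≡ (if f x then x ∷ filterᵇ f xs else filterᵇ f xs)
filterᵇ-∷ f x xs with f x
... | true  = refl
... | false = refl

module _ {n : ℕ} (σ : Permutation′ n) where

  descentAt : ℕ → Bool
  descentAt i = val σ (suc i) <ᵇ val σ i

  descentWord : Word
  descentWord = map descentAt (interval 1 (n ∸ 1))

  length-descentWord : length descentWord ≡ n ∸ 1
  length-descentWord = trans (length-map descentAt (interval 1 (n ∸ 1))) (length-interval 1 (n ∸ 1))

  Des≡select : Des σ ≡ select (interval 1 (n ∸ 1)) descentWord
  Des≡select = trans (cong (filterᵇ descentAt) (map-suc-upTo (n ∸ 1))) (filterᵇ≡select descentAt (interval 1 (n ∸ 1)))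

  val-suc : ∀ a (a<n : a < n) → val σ (suc a) ≡ suc (toℕ (σ ⟨$⟩ʳ fromℕ< a<n))
  val-suc a a<n with a ℕ.<? n
  ... | yes a<n′ = cong (λ z → suc (toℕ (σ ⟨$⟩ʳ z))) (fromℕ<-cong a a refl a<n′ a<n)
  ... | no  a≮n  = ⊥-elim (a≮n a<n)

  val-injective : ∀ a b (a<n : a < n) (b<n : b < n) → val σ (suc a) ≡ val σ (suc b) → a ≡ b
  val-injective a b a<n b<n e = trans (sym (toℕ-fromℕ< a<n)) (trans (cong toℕ sameArg) (toℕ-fromℕ< b<n))
    where
    sameImage : σ ⟨$⟩ʳ fromℕ< a<n ≡ σ ⟨$⟩ʳ fromℕ< b<n
    sameImage = toℕ-injective (suc-injective (trans (sym (val-suc a a<n)) (trans e (val-suc b b<n))))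
    sameArg : fromℕ< a<n ≡ fromℕ< b<n
    sameArg = trans (sym (inverseˡ σ)) (trans (cong (σ ⟨$⟩ˡ_) sameImage) (inverseˡ σ))

  peakAt : ℕ → Bool
  peakAt i = (val σ (i ∸ 1) <ᵇ val σ i) ∧ (val σ (suc i) <ᵇ val σ i)

  -- b records whether position o is a descent
  peaks-interval : ∀ o m b → suc o + m ≤ n → (val σ o <ᵇ val σ (suc o)) ≡ not b →
    length (filterᵇ peakAt (interval (suc o) m)) ≡ peaksAfter b (map descentAt (interval (suc o) m))
  peaks-interval o zero    b _ _ = refl
  peaks-interval o (suc m) b 1+o+m≤n ascent = begin
      length (filterᵇ peakAt (suc o ∷ rest))
    ≡⟨ cong length (filterᵇ-∷ peakAt (suc o) rest) ⟩
      length (if peakAt (suc o) then suc o ∷ filterᵇ peakAt rest else filterᵇ peakAt rest)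
    ≡⟨ cong (λ z → length (if z ∧ descentAt (suc o) then suc o ∷ filterᵇ peakAt rest else filterᵇ peakAt rest)) ascent ⟩
      length (if not b ∧ descentAt (suc o) then suc o ∷ filterᵇ peakAt rest else filterᵇ peakAt rest)
    ≡⟨ byCase b (descentAt (suc o)) refl ⟩
      peaksAfter b (descentAt (suc o) ∷ map descentAt rest) ∎
    where
    open ≡-Reasoning
    rest = interval (suc (suc o)) m
    2+o+m≤n : suc (suc o) + m ≤ n
    2+o+m≤n = subst (_≤ n) (+-suc (suc o) m) 1+o+m≤n
    distinct : val σ (suc o) ≢ val σ (suc (suc o))
    distinct e = 1+n≢n (sym (val-injective o (suc o) (≤-trans (s≤s (m≤m+n o (suc m))) 1+o+m≤n)
                                                     (≤-trans (s≤s (s≤s (m≤m+n o m))) 2+o+m≤n) e))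
    next : ∀ x → descentAt (suc o) ≡ x → (val σ (suc o) <ᵇ val σ (suc (suc o))) ≡ not x
    next x e = trans (<ᵇ-flip _ _ distinct) (cong not e)
    byCase : ∀ b x → descentAt (suc o) ≡ x →
      length (if not b ∧ x then suc o ∷ filterᵇ peakAt rest else filterᵇ peakAt rest) ≡ peaksAfter b (x ∷ map descentAt rest)
    byCase asc asc e = peaks-interval (suc o) m asc 2+o+m≤n (next asc e)
    byCase asc des e = cong suc (peaks-interval (suc o) m des 2+o+m≤n (next des e))
    byCase des asc e = peaks-interval (suc o) m asc 2+o+m≤n (next asc e)
    byCase des des e = peaks-interval (suc o) m des 2+o+m≤n (next des e)

  lpk≡peaks : 1 ≤ n → lpk σ ≡ peaks descentWord
  lpk≡peaks (s≤s z≤n) =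
    trans (cong (λ z → length (filterᵇ peakAt z)) (map-suc-upTo (n ∸ 1)))
          (peaks-interval 0 (n ∸ 1) asc (≤-reflexive (m+[n∸m]≡n (s≤s z≤n))) (cong (0 <ᵇ_) (val-suc 0 (s≤s z≤n))))

  Vn≡vWord : ∀ k → 1 ≤ n → Vn k n σ ≡ toℚ (vWord k descentWord)
  Vn≡vWord k 1≤n@(s≤s z≤n) =
    trans (cong (λ x → ev n x σ) (Vplus≡ k n))
      (trans (ev-unitCoeffs n (Vᶜ k n) σ)
        (cong toℚ (trans (countDescSet≡countWord (n ∸ 1) (Vᶜ k n) descentWord (Des σ) compsOfN length-descentWord Des≡select)
                         (trans (cong (λ z → countWord descentWord (Vᶜ k z)) n≡1+|w|) (countWord-Vᶜ k descentWord)))))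
    where
    n≡1+|w| : n ≡ suc (length descentWord)
    n≡1+|w| = trans (sym (m+[n∸m]≡n 1≤n)) (cong suc (sym length-descentWord))
    compsOfN : All (IsCompOf (suc (n ∸ 1))) (Vᶜ k n)
    compsOfN = subst (λ z → All (IsCompOf z) (Vᶜ k n)) (sym (m+[n∸m]≡n 1≤n)) (IsCompSeries-Vᶜ k n)

-- A permutation with l left peaks: 2 1 4 3 ⋯ 2l (2l-1) (2l+1) ⋯ n

swapPairs : ℕ → ℕ → ℕ
swapPairs zero    p             = p
swapPairs (suc l) zero          = 1
swapPairs (suc l) (suc zero)    = 0
swapPairs (suc l) (suc (suc p)) = suc (suc (swapPairs l p))

swapPairs-involutive : ∀ l p → swapPairs l (swapPairs l p) ≡ p
swapPairs-involutive zero    p             = refl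
swapPairs-involutive (suc l) zero          = refl
swapPairs-involutive (suc l) (suc zero)    = refl
swapPairs-involutive (suc l) (suc (suc p)) = cong (λ z → suc (suc z)) (swapPairs-involutive l p)

swapPairs-< : ∀ l n p → double l ≤ n → p < n → swapPairs l p < n
swapPairs-< zero    n             p             _ p<n = p<n
swapPairs-< (suc l) (suc zero)    p             (s≤s ()) _
swapPairs-< (suc l) (suc (suc n)) zero          _ _ = s≤s (s≤s z≤n)
swapPairs-< (suc l) (suc n)       (suc zero)    _ _ = s≤s z≤n
swapPairs-< (suc l) (suc (suc n)) (suc (suc p)) (s≤s (s≤s 2l≤n)) (s≤s (s≤s p<n)) = s≤s (s≤s (swapPairs-< l n p 2l≤n p<n))

pairSwap : ∀ n l → double l ≤ n → Permutation′ n
pairSwap n l 2l≤n = permutation f f f∘f f∘f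
  where
  f : Fin n → Fin n
  f x = fromℕ< (swapPairs-< l n (toℕ x) 2l≤n (toℕ<n x))
  f∘f : ∀ x → f (f x) ≡ x
  f∘f x = toℕ-injective (trans (toℕ-fromℕ< _) (trans (cong (swapPairs l) (toℕ-fromℕ< _)) (swapPairs-involutive l (toℕ x))))

val-pairSwap : ∀ n l (2l≤n : double l ≤ n) a → a < n → val (pairSwap n l 2l≤n) (suc a) ≡ suc (swapPairs l a)
val-pairSwap n l 2l≤n a a<n =
  trans (val-suc (pairSwap n l 2l≤n) a a<n) (cong suc (trans (toℕ-fromℕ< _) (cong (swapPairs l) (toℕ-fromℕ< a<n))))

descents : (ℕ → ℕ) → ℕ → ℕ → Word
descents v o m = map (λ i → v i <ᵇ v (i ∸ 1)) (interval o m)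

map-interval-cong : ∀ (f g : ℕ → Bool) o m → (∀ i → o ≤ i → i < o + m → f i ≡ g i) → map f (interval o m) ≡ map g (interval o m)
map-interval-cong f g o zero    e = refl
map-interval-cong f g o (suc m) e = cong₂ _∷_ (e o ≤-refl (m<m+n o (s≤s z≤n)))
  (map-interval-cong f g (suc o) m (λ i o<i i<o+1+m → e i (≤-trans (n≤1+n o) o<i) (subst (i <_) (sym (+-suc o m)) i<o+1+m)))

map-interval-suc : ∀ (f : ℕ → Bool) o m → map f (interval (suc o) m) ≡ map (λ j → f (suc j)) (interval o m)
map-interval-suc f o zero    = refl
map-interval-suc f o (suc m) = cong (f (suc o) ∷_) (map-interval-suc f (suc o) m)

n<ᵇn∸1≡false : ∀ i → (i <ᵇ i ∸ 1) ≡ false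
n<ᵇn∸1≡false zero          = refl
n<ᵇn∸1≡false (suc zero)    = refl
n<ᵇn∸1≡false (suc (suc i)) = n<ᵇn∸1≡false (suc i)

peaks-ascending : ∀ o m → peaks (descents (λ i → i) o m) ≡ 0
peaks-ascending o zero    = refl
peaks-ascending o (suc m) rewrite n<ᵇn∸1≡false o = peaks-ascending (suc o) m

peaks-swapPairs : ∀ l M → double l ≤ suc M → peaks (descents (swapPairs l) 1 M) ≡ l
peaks-swapPairs zero          M           _ = peaks-ascending 1 M
peaks-swapPairs (suc l)       zero        (s≤s ())
peaks-swapPairs (suc zero)    (suc zero)  _ = refl
peaks-swapPairs (suc (suc l)) (suc zero)  (s≤s (s≤s ()))
peaks-swapPairs (suc l) (suc (suc m)) (s≤s (s≤s 2l≤1+m)) =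
  cong suc (trans (cong peaks (trans (map-interval-suc _ 2 m) (trans (map-interval-suc _ 1 m)
    (map-interval-cong _ _ 1 m (λ { (suc j) _ _ → refl }))))) (peaks-swapPairs l m 2l≤1+m))

lpk-pairSwap : ∀ n l → 1 ≤ n → (2l≤n : double l ≤ n) → lpk (pairSwap n l 2l≤n) ≡ l
lpk-pairSwap n l 1≤n 2l≤n =
  trans (lpk≡peaks σ 1≤n) (trans (cong peaks sameWord) (peaks-swapPairs l (n ∸ 1) (subst (double l ≤_) (sym (m+[n∸m]≡n 1≤n)) 2l≤n)))
  where
  σ = pairSwap n l 2l≤n
  sameWord : descentWord σ ≡ descents (swapPairs l) 1 (n ∸ 1)
  sameWord = map-interval-cong _ _ 1 (n ∸ 1) λ where
    (suc j) _ j<n∸1+1 → let 1+j<n = subst (suc j <_) (m+[n∸m]≡n 1≤n) j<n∸1+1 in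
      cong₂ _<ᵇ_ (val-pairSwap n l 2l≤n (suc j) 1+j<n) (val-pairSwap n l 2l≤n j (≤-trans (n≤1+n (suc j)) 1+j<n))

-- Finite linear combinations over ℚ

sumFirstℚ : (ℕ → ℚ) → ℕ → ℚ
sumFirstℚ g zero    = 0ℚ
sumFirstℚ g (suc m) = g 0 +ℚ sumFirstℚ (λ i → g (suc i)) m

lin≡sumFirstℚ : ∀ m c f → lin m c f ≡ sumFirstℚ (λ i → c i *ℚ f i) m
lin≡sumFirstℚ m c f = go (λ i → c i *ℚ f i) (λ i → i) m
  where
  go : ∀ (g : ℕ → ℚ) (h : ℕ → ℕ) m → sumℚ (map g (applyUpTo h m)) ≡ sumFirstℚ (λ i → g (h i)) m
  go g h zero    = refl
  go g h (suc m) = cong (g (h 0) +ℚ_) (go g (λ i → h (suc i)) m)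

sumFirstℚ-cong : ∀ {g h} m → (∀ i → i < m → g i ≡ h i) → sumFirstℚ g m ≡ sumFirstℚ h m
sumFirstℚ-cong zero    e = refl
sumFirstℚ-cong (suc m) e = cong₂ _+ℚ_ (e 0 (s≤s z≤n)) (sumFirstℚ-cong m (λ i i<m → e (suc i) (s≤s i<m)))

sumFirstℚ-zero : ∀ {g} m → (∀ i → i < m → g i ≡ 0ℚ) → sumFirstℚ g m ≡ 0ℚ
sumFirstℚ-zero zero    e = refl
sumFirstℚ-zero (suc m) e =
  trans (cong₂ _+ℚ_ (e 0 (s≤s z≤n)) (sumFirstℚ-zero m (λ i i<m → e (suc i) (s≤s i<m)))) (ℚ.+-identityˡ 0ℚ)

sumFirstℚ-single : ∀ {g} m l → l < m → (∀ i → i < m → i ≢ l → g i ≡ 0ℚ) → sumFirstℚ g m ≡ g l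
sumFirstℚ-single {g} (suc m) zero    _ e =
  trans (cong (g 0 +ℚ_) (sumFirstℚ-zero m (λ i i<m → e (suc i) (s≤s i<m) (λ ())))) (ℚ.+-identityʳ (g 0))
sumFirstℚ-single     (suc m) (suc l) (s≤s l<m) e =
  trans (cong₂ _+ℚ_ (e 0 (s≤s z≤n) (λ ()))
                    (sumFirstℚ-single m l l<m (λ i i<m i≢l → e (suc i) (s≤s i<m) (λ 1+i≡1+l → i≢l (suc-injective 1+i≡1+l)))))
        (ℚ.+-identityˡ _)

sumFirstℚ-+ : ∀ g h m → sumFirstℚ (λ i → g i +ℚ h i) m ≡ sumFirstℚ g m +ℚ sumFirstℚ h m
sumFirstℚ-+ g h zero    = refl
sumFirstℚ-+ g h (suc m) =
  trans (cong ((g 0 +ℚ h 0) +ℚ_) (sumFirstℚ-+ (λ i → g (suc i)) (λ i → h (suc i)) m))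
        (+ℚ-interchange (g 0) (h 0) _ _)

sumFirstℚ-* : ∀ α g m → sumFirstℚ (λ i → α *ℚ g i) m ≡ α *ℚ sumFirstℚ g m
sumFirstℚ-* α g zero    = sym (ℚ.*-zeroʳ α)
sumFirstℚ-* α g (suc m) =
  trans (cong (α *ℚ g 0 +ℚ_) (sumFirstℚ-* α (λ i → g (suc i)) m)) (sym (ℚ.*-distribˡ-+ α (g 0) _))

≡ᵇ-refl : ∀ a → (a ≡ᵇ a) ≡ true
≡ᵇ-refl zero    = refl
≡ᵇ-refl (suc a) = ≡ᵇ-refl a

≢⇒≡ᵇ-false : ∀ a b → a ≢ b → (a ≡ᵇ b) ≡ false
≢⇒≡ᵇ-false zero    zero    a≢b = ⊥-elim (a≢b refl)
≢⇒≡ᵇ-false zero    (suc b) a≢b = refl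
≢⇒≡ᵇ-false (suc a) zero    a≢b = refl
≢⇒≡ᵇ-false (suc a) (suc b) a≢b = ≢⇒≡ᵇ-false a b (λ e → a≢b (cong suc e))

indicator : ℕ → ℕ → ℚ
indicator b l = if b ≡ᵇ l then 1ℚ else 0ℚ

indicator-≢ : ∀ {b l} → b ≢ l → indicator b l ≡ 0ℚ
indicator-≢ {b} {l} b≢l = if-false (≢⇒≡ᵇ-false b l b≢l)

indicator-refl : ∀ b → indicator b b ≡ 1ℚ
indicator-refl b = if-true (≡ᵇ-refl b)

lin-indicator : ∀ m c b → b < m → lin m c (indicator b) ≡ c b
lin-indicator m c b b<m = trans (lin≡sumFirstℚ m c _)
  (trans (sumFirstℚ-single m b b<m (λ i _ i≢b → trans (cong (c i *ℚ_) (indicator-≢ (λ b≡i → i≢b (sym b≡i)))) (ℚ.*-zeroʳ (c i))))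
         (trans (cong (c b *ℚ_) (indicator-refl b)) (ℚ.*-identityʳ (c b))))

lin-indicator-≥ : ∀ m c b → m ≤ b → lin m c (indicator b) ≡ 0ℚ
lin-indicator-≥ m c b m≤b = trans (lin≡sumFirstℚ m c _)
  (sumFirstℚ-zero m (λ i i<m → trans (cong (c i *ℚ_) (indicator-≢ (λ b≡i → <⇒≢ (<-≤-trans i<m m≤b) (sym b≡i)))) (ℚ.*-zeroʳ (c i))))

*-cancelʳ-nonZero : ∀ x y → .{{_ : NonZero y}} → x *ℚ y ≡ 0ℚ → x ≡ 0ℚ
*-cancelʳ-nonZero x y xy≡0 =
  trans (sym (ℚ.*-identityʳ x))
    (trans (cong (x *ℚ_) (sym (ℚ.*-inverseʳ y)))
      (trans (sym (ℚ.*-assoc x y (1/ y)))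
        (trans (cong (_*ℚ (1/ y)) xy≡0) (ℚ.*-zeroˡ (1/ y)))))

module _ {X : Set} (F : ℕ → X → ℚ) (m : ℕ) where

  InSpan : (X → ℚ) → Set
  InSpan f = ∃ λ c → ∀ x → f x ≡ lin m c (λ k → F k x)

  InSpan-≗ : ∀ {f g} → (∀ x → g x ≡ f x) → InSpan f → InSpan g
  InSpan-≗ g≗f (c , f≡) = c , λ x → trans (g≗f x) (f≡ x)

  InSpan-0 : InSpan (λ _ → 0ℚ)
  InSpan-0 = (λ _ → 0ℚ) , λ x →
    sym (trans (lin≡sumFirstℚ m (λ _ → 0ℚ) (λ k → F k x)) (sumFirstℚ-zero m (λ k _ → ℚ.*-zeroˡ (F k x))))

  InSpan-+ : ∀ {f g} → InSpan f → InSpan g → InSpan (λ x → f x +ℚ g x)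
  InSpan-+ (c , f≡) (d , g≡) = (λ k → c k +ℚ d k) , λ x →
    trans (cong₂ _+ℚ_ (trans (f≡ x) (lin≡sumFirstℚ m c _)) (trans (g≡ x) (lin≡sumFirstℚ m d _)))
      (sym (trans (lin≡sumFirstℚ m (λ k → c k +ℚ d k) _)
        (trans (sumFirstℚ-cong m (λ k _ → ℚ.*-distribʳ-+ (F k x) (c k) (d k)))
               (sumFirstℚ-+ (λ k → c k *ℚ F k x) (λ k → d k *ℚ F k x) m))))

  InSpan-* : ∀ α {f} → InSpan f → InSpan (λ x → α *ℚ f x)
  InSpan-* α (c , f≡) = (λ k → α *ℚ c k) , λ x →
    trans (cong (α *ℚ_) (trans (f≡ x) (lin≡sumFirstℚ m c _)))
      (sym (trans (lin≡sumFirstℚ m (λ k → α *ℚ c k) _)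
        (trans (sumFirstℚ-cong m (λ k _ → ℚ.*-assoc α (c k) (F k x)))
               (sumFirstℚ-* α (λ k → c k *ℚ F k x) m))))

  InSpan-generator : ∀ k → k < m → InSpan (F k)
  InSpan-generator k k<m = indicator k , λ x → sym (trans (lin≡sumFirstℚ m (indicator k) (λ i → F i x))
    (trans (sumFirstℚ-single m k k<m (λ i _ i≢k → trans (cong (_*ℚ F i x) (indicator-≢ (λ k≡i → i≢k (sym k≡i)))) (ℚ.*-zeroˡ (F i x))))
           (trans (cong (_*ℚ F k x) (indicator-refl k)) (ℚ.*-identityˡ (F k x)))))

  InSpan-lin : ∀ l (a : ℕ → ℚ) (G : ℕ → X → ℚ) → (∀ j → j < l → InSpan (G j)) → InSpan (λ x → lin l a (λ j → G j x))
  InSpan-lin l a G spanned = InSpan-≗ (λ x → lin≡sumFirstℚ l a (λ j → G j x)) (go l a G spanned)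
    where
    go : ∀ l (a : ℕ → ℚ) (G : ℕ → X → ℚ) → (∀ j → j < l → InSpan (G j)) → InSpan (λ x → sumFirstℚ (λ j → a j *ℚ G j x) l)
    go zero    a G _       = InSpan-0
    go (suc l) a G spanned = InSpan-+ (InSpan-* (a 0) (spanned 0 (s≤s z≤n)))
      (go l (λ j → a (suc j)) (λ j → G (suc j)) (λ j j<l → spanned (suc j) (s≤s j<l)))

  -- F l = q l · G l + (lower G's), with q l ≠ 0, can be solved for G l by induction on l.
  InSpan-triangular : (G : ℕ → X → ℚ) (q : ℕ → ℚ) → (∀ l → l < m → NonZero (q l)) →
    (∀ l → l < m → ∃ λ a → ∀ x → F l x ≡ q l *ℚ G l x +ℚ lin l a (λ j → G j x)) →
    ∀ l → l < m → InSpan (G l)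
  InSpan-triangular G q q≢0 triangular l = go l l ≤-refl
    where
    solveFor : ∀ q P S → .{{_ : NonZero q}} → (1/ q) *ℚ ((q *ℚ P +ℚ S) +ℚ (- 1ℚ) *ℚ S) ≡ P
    solveFor q P S = begin
        (1/ q) *ℚ ((q *ℚ P +ℚ S) +ℚ (- 1ℚ) *ℚ S)
      ≡⟨ cong (λ z → (1/ q) *ℚ ((q *ℚ P +ℚ S) +ℚ z)) (trans (sym (ℚ.neg-distribˡ-* 1ℚ S)) (cong -_ (ℚ.*-identityˡ S))) ⟩
        (1/ q) *ℚ ((q *ℚ P +ℚ S) +ℚ (- S))
      ≡⟨ cong ((1/ q) *ℚ_) (trans (ℚ.+-assoc (q *ℚ P) S (- S)) (trans (cong (q *ℚ P +ℚ_) (ℚ.+-inverseʳ S)) (ℚ.+-identityʳ _))) ⟩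
        (1/ q) *ℚ (q *ℚ P)
      ≡⟨ trans (sym (ℚ.*-assoc (1/ q) q P)) (trans (cong (_*ℚ P) (ℚ.*-inverseˡ q)) (ℚ.*-identityˡ P)) ⟩
        P ∎
      where open ≡-Reasoning
    solveLevel : ∀ l → l < m → (∀ j → j < l → InSpan (G j)) → InSpan (G l)
    solveLevel l l<m lower with triangular l l<m
    ... | a , F≡ = InSpan-≗ G≡ (InSpan-* (1/ q l) (InSpan-+ (InSpan-generator l l<m) (InSpan-* (- 1ℚ) (InSpan-lin l a G lower))))
      where
      instance
        q≢0′ : NonZero (q l)
        q≢0′ = q≢0 l l<m
      G≡ : ∀ x → G l x ≡ (1/ q l) *ℚ (F l x +ℚ (- 1ℚ) *ℚ lin l a (λ j → G j x))
      G≡ x = sym (trans (cong (λ z → (1/ q l) *ℚ (z +ℚ (- 1ℚ) *ℚ lin l a (λ j → G j x))) (F≡ x)) (solveFor (q l) (G l x) _))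
    go : ∀ t l → l ≤ t → l < m → InSpan (G l)
    go zero    l l≤0   l<m = solveLevel l l<m (λ j j<l → ⊥-elim (<⇒≱ (<-≤-trans j<l l≤0) z≤n))
    go (suc t) l l≤1+t l<m = solveLevel l l<m (λ j j<l → go t j (≤-pred (<-≤-trans j<l l≤1+t)) (<-trans j<l l<m))

  -- Evaluating at points x l where the F's are triangular shows independence, from the top down.
  lin-independent : (x : ∀ l → l < m → X) →
    (∀ k l (l<m : l < m) → k < l → F k (x l l<m) ≡ 0ℚ) → (∀ l (l<m : l < m) → NonZero (F l (x l l<m))) →
    ∀ c → (∀ y → lin m c (λ k → F k y) ≡ 0ℚ) → ∀ k → k < m → c k ≡ 0ℚ
  lin-independent x below diagonal c c·F≡0 k k<m = vanishAbove m k k<m (≤-trans (n≤1+n _) (s≤s (m≤n+m m k)))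
    where
    atPoint : ∀ l (l<m : l < m) → (∀ k → l < k → k < m → c k ≡ 0ℚ) → c l ≡ 0ℚ
    atPoint l l<m above = *-cancelʳ-nonZero (c l) (F l (x l l<m)) {{diagonal l l<m}}
      (trans (sym (sumFirstℚ-single m l l<m offDiagonal)) (trans (sym (lin≡sumFirstℚ m c _)) (c·F≡0 (x l l<m))))
      where
      offDiagonal : ∀ i → i < m → i ≢ l → c i *ℚ F i (x l l<m) ≡ 0ℚ
      offDiagonal i i<m i≢l with <-cmp i l
      ... | tri< i<l _ _ = trans (cong (c i *ℚ_) (below i l l<m i<l)) (ℚ.*-zeroʳ (c i))
      ... | tri≈ _ i≡l _ = ⊥-elim (i≢l i≡l)
      ... | tri> _ _ l<i = trans (cong (_*ℚ F i (x l l<m)) (above i l<i i<m)) (ℚ.*-zeroˡ (F i (x l l<m)))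
    vanishAbove : ∀ t k → k < m → m ≤ suc (k + t) → c k ≡ 0ℚ
    vanishAbove zero    k k<m m≤1+k = atPoint k k<m (λ k′ k<k′ k′<m →
      ⊥-elim (<⇒≱ (<-≤-trans k′<m (subst (m ≤_) (cong suc (+-identityʳ k)) m≤1+k)) k<k′))
    vanishAbove (suc t) k k<m m≤1+k+1+t = atPoint k k<m (λ k′ k<k′ k′<m →
      vanishAbove t k′ k′<m (≤-trans m≤1+k+1+t (s≤s (subst (_≤ k′ + t) (sym (+-suc k t)) (+-monoˡ-≤ t k<k′)))))

toℚ-+ : ∀ a b → toℚ (a + b) ≡ toℚ a +ℚ toℚ b
toℚ-+ zero    b = sym (ℚ.+-identityˡ (toℚ b))
toℚ-+ (suc a) b = trans (cong (1ℚ +ℚ_) (toℚ-+ a b)) (sym (ℚ.+-assoc 1ℚ (toℚ a) (toℚ b)))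

toℚ-nonNegative : ∀ n → NonNegative (toℚ n)
toℚ-nonNegative zero    = _
toℚ-nonNegative (suc n) = ℚ.nonNeg+nonNeg⇒nonNeg 1ℚ (toℚ n) {{toℚ-nonNegative n}}

toℚ-nonZero : ∀ n → .{{_ : ℕ.NonZero n}} → NonZero (toℚ n)
toℚ-nonZero (suc n) = ℚ.pos⇒nonZero (toℚ (suc n)) {{ℚ.pos+nonNeg⇒pos 1ℚ (toℚ n) {{toℚ-nonNegative n}}}}

pow2≡toℚ : ∀ m → pow2 m ≡ toℚ (2 ^ m)
pow2≡toℚ zero    = refl
pow2≡toℚ (suc m) = begin
    (1ℚ +ℚ 1ℚ) *ℚ pow2 m
  ≡⟨ trans (ℚ.*-distribʳ-+ (pow2 m) 1ℚ 1ℚ) (cong₂ _+ℚ_ (ℚ.*-identityˡ (pow2 m)) (ℚ.*-identityˡ (pow2 m))) ⟩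
    pow2 m +ℚ pow2 m
  ≡⟨ cong₂ _+ℚ_ (pow2≡toℚ m) (trans (pow2≡toℚ m) (cong toℚ (sym (+-identityʳ (2 ^ m))))) ⟩
    toℚ (2 ^ m) +ℚ toℚ (2 ^ m + 0)
  ≡⟨ sym (toℚ-+ (2 ^ m) (2 ^ m + 0)) ⟩
    toℚ (2 ^ suc m) ∎
  where open ≡-Reasoning

toℚ-4^ : ∀ k → toℚ (4 ^ k) ≡ pow2 (2 * k)
toℚ-4^ k = trans (cong toℚ (^-*-assoc 2 2 k)) (sym (pow2≡toℚ (2 * k)))

toℚ-4^-nonZero : ∀ k → NonZero (toℚ (4 ^ k))
toℚ-4^-nonZero k = toℚ-nonZero (4 ^ k) {{m^n≢0 4 k}}

mutual
  double-peaksAfter-asc : ∀ w → 2 * peaksAfter asc w ≤ suc (length w)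
  double-peaksAfter-asc []        = z≤n
  double-peaksAfter-asc (asc ∷ w) = ≤-trans (double-peaksAfter-asc w) (n≤1+n _)
  double-peaksAfter-asc (des ∷ w) =
    subst (_≤ suc (suc (length w))) (sym (*-suc 2 (peaksAfter des w))) (s≤s (s≤s (double-peaksAfter-des w)))

  double-peaksAfter-des : ∀ w → 2 * peaksAfter des w ≤ length w
  double-peaksAfter-des []        = z≤n
  double-peaksAfter-des (asc ∷ w) = double-peaksAfter-asc w
  double-peaksAfter-des (des ∷ w) = ≤-trans (double-peaksAfter-des w) (n≤1+n _)

double≡*2 : ∀ l → double l ≡ l * 2
double≡*2 zero    = refl
double≡*2 (suc l) = cong (λ z → suc (suc z)) (double≡*2 l)

double≤⇒≤/2 : ∀ l n → 2 * l ≤ n → l ≤ n / 2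
double≤⇒≤/2 l n 2l≤n = subst (_≤ n / 2) (m*n/n≡m l 2) (/-monoˡ-≤ 2 (subst (_≤ n) (*-comm 2 l) 2l≤n))

≤/2⇒double≤ : ∀ l n → l ≤ n / 2 → double l ≤ n
≤/2⇒double≤ l n l≤n/2 = subst (_≤ n) (sym (double≡*2 l)) (≤-trans (*-monoˡ-≤ 2 l≤n/2) (m/n*n≤m n 2))

peakValue : ℕ → ℕ → ℕ → ℚ
peakValue n k l = toℚ (vWordOfShape k l (n ∸ 1))

module _ {n : ℕ} (1≤n : 1 ≤ n) where

  Vn≡peakValue : ∀ k (σ : Permutation′ n) → Vn k n σ ≡ peakValue n k (lpk σ)
  Vn≡peakValue k σ = trans (Vn≡vWord σ k 1≤n)
    (cong toℚ (trans (vWord-by-shape k (descentWord σ)) (cong₂ (vWordOfShape k) (sym (lpk≡peaks σ 1≤n)) (length-descentWord σ))))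

  Vn-vanish : ∀ k (σ : Permutation′ n) → k < lpk σ → Vn k n σ ≡ 0ℚ
  Vn-vanish k σ k<lpk =
    trans (Vn≡vWord σ k 1≤n) (cong toℚ (vWord-vanish k (descentWord σ) (subst (k <_) (lpk≡peaks σ 1≤n) k<lpk)))

  Vn-top : ∀ k (σ : Permutation′ n) → lpk σ ≡ k → Vn k n σ ≡ toℚ (4 ^ k)
  Vn-top k σ lpk≡k = trans (Vn≡vWord σ k 1≤n) (cong toℚ (vWord-top k (descentWord σ) (trans (sym (lpk≡peaks σ 1≤n)) lpk≡k)))

  lpk≤n/2 : (σ : Permutation′ n) → lpk σ ≤ n / 2
  lpk≤n/2 σ = double≤⇒≤/2 (lpk σ) n (subst (λ z → 2 * z ≤ n) (sym (lpk≡peaks σ 1≤n))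
    (subst (2 * peaks (descentWord σ) ≤_) (trans (cong suc (length-descentWord σ)) (m+[n∸m]≡n 1≤n))
           (double-peaksAfter-asc (descentWord σ))))

  permutationWithPeaks : ∀ l → l < suc (n / 2) → Permutation′ n
  permutationWithPeaks l l<1+n/2 = pairSwap n l (≤/2⇒double≤ l n (≤-pred l<1+n/2))

  lpk-permutationWithPeaks : ∀ l (l<1+n/2 : l < suc (n / 2)) → lpk (permutationWithPeaks l l<1+n/2) ≡ l
  lpk-permutationWithPeaks l l<1+n/2 = lpk-pairSwap n l 1≤n (≤/2⇒double≤ l n (≤-pred l<1+n/2))

  Vn∈span-Pcirc : ∀ k → ∃ λ (c : ℕ → ℚ) → ∀ σ → Vn k n σ ≡ lin (suc (n / 2)) c (λ l → Pcirc l n σ)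
  Vn∈span-Pcirc k = peakValue n k , λ σ →
    trans (Vn≡peakValue k σ) (sym (lin-indicator (suc (n / 2)) (peakValue n k) (lpk σ) (s≤s (lpk≤n/2 σ))))

  Vn-triangular : ∀ k → ∃ λ (a : ℕ → ℚ) → ∀ σ →
    Vn k n σ ≡ (pow2 (2 * k) *ℚ Pcirc k n σ) +ℚ lin k a (λ l → Pcirc l n σ)
  Vn-triangular k = peakValue n k , λ σ → byPeaks σ (<-cmp (lpk σ) k)
    where
    q = pow2 (2 * k)
    byPeaks : ∀ σ → Tri (lpk σ < k) (lpk σ ≡ k) (k < lpk σ) →
      Vn k n σ ≡ (q *ℚ indicator (lpk σ) k) +ℚ lin k (peakValue n k) (indicator (lpk σ))
    byPeaks σ (tri< lpk<k _ _) = sym (trans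
      (cong₂ _+ℚ_ (trans (cong (q *ℚ_) (indicator-≢ (<⇒≢ lpk<k))) (ℚ.*-zeroʳ q)) (lin-indicator k (peakValue n k) (lpk σ) lpk<k))
      (trans (ℚ.+-identityˡ _) (sym (Vn≡peakValue k σ))))
    byPeaks σ (tri≈ _ lpk≡k _) = trans (Vn-top k σ lpk≡k) (trans (toℚ-4^ k) (sym (trans
      (cong₂ _+ℚ_ (trans (cong (q *ℚ_) (trans (cong (λ z → indicator z k) lpk≡k) (indicator-refl k))) (ℚ.*-identityʳ q))
                  (lin-indicator-≥ k (peakValue n k) (lpk σ) (≤-reflexive (sym lpk≡k))))
      (ℚ.+-identityʳ q))))
    byPeaks σ (tri> _ _ k<lpk) = trans (Vn-vanish k σ k<lpk) (sym (trans
      (cong₂ _+ℚ_ (trans (cong (q *ℚ_) (indicator-≢ (λ e → <⇒≢ k<lpk (sym e)))) (ℚ.*-zeroʳ q))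
                  (lin-indicator-≥ k (peakValue n k) (lpk σ) (<⇒≤ k<lpk)))
      (ℚ.+-identityˡ 0ℚ)))

  Vn-independent : ∀ (c : ℕ → ℚ) → (∀ σ → lin (suc (n / 2)) c (λ k → Vn k n σ) ≡ 0ℚ) → ∀ k → k ≤ n / 2 → c k ≡ 0ℚ
  Vn-independent c c·V≡0 k k≤n/2 =
    lin-independent (λ k σ → Vn k n σ) (suc (n / 2)) permutationWithPeaks below diagonal c c·V≡0 k (s≤s k≤n/2)
    where
    below : ∀ k l l<1+n/2 → k < l → Vn k n (permutationWithPeaks l l<1+n/2) ≡ 0ℚ
    below k l l<1+n/2 k<l = Vn-vanish k _ (subst (k <_) (sym (lpk-permutationWithPeaks l l<1+n/2)) k<l)
    diagonal : ∀ l l<1+n/2 → NonZero (Vn l n (permutationWithPeaks l l<1+n/2))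
    diagonal l l<1+n/2 = subst NonZero (sym (Vn-top l _ (lpk-permutationWithPeaks l l<1+n/2))) (toℚ-4^-nonZero l)

  Pcirc-lin∈span-Vn : ∀ (d : ℕ → ℚ) → ∃ λ (c : ℕ → ℚ) → ∀ σ →
    lin (suc (n / 2)) d (λ l → Pcirc l n σ) ≡ lin (suc (n / 2)) c (λ k → Vn k n σ)
  Pcirc-lin∈span-Vn d = InSpan-lin V (suc (n / 2)) (suc (n / 2)) d P
    (InSpan-triangular V (suc (n / 2)) P (λ l → pow2 (2 * l)) pow2≢0 (λ l _ → Vn-triangular l))
    where
    V P : ℕ → Permutation′ n → ℚ
    V k σ = Vn k n σ
    P l σ = Pcirc l n σ
    pow2≢0 : ∀ l → l < suc (n / 2) → NonZero (pow2 (2 * l))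
    pow2≢0 l _ = subst NonZero (toℚ-4^ l) (toℚ-4^-nonZero l)

proposition4p3 : (n : ℕ) → 2 ≤ n →
    ((k : ℕ) → ∃ λ (c : ℕ → ℚ) → (σ : Permutation′ n) →
        Vn k n σ ≡ lin (suc (n / 2)) c (λ l → Pcirc l n σ))
  × ((k : ℕ) → k ≤ n / 2 → ∃ λ (a : ℕ → ℚ) → (σ : Permutation′ n) →
        Vn k n σ ≡ (pow2 (2 * k) *ℚ Pcirc k n σ) +ℚ lin k a (λ l → Pcirc l n σ))
  × ((c : ℕ → ℚ) →
        ((σ : Permutation′ n) → lin (suc (n / 2)) c (λ k → Vn k n σ) ≡ 0ℚ) →
        (k : ℕ) → k ≤ n / 2 → c k ≡ 0ℚ)
  × ((d : ℕ → ℚ) → ∃ λ (c : ℕ → ℚ) → (σ : Permutation′ n) →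
        lin (suc (n / 2)) d (λ l → Pcirc l n σ)
          ≡ lin (suc (n / 2)) c (λ k → Vn k n σ))
-- The triangular form holds for every k.
proposition4p3 n 2≤n =
  Vn∈span-Pcirc 1≤n , (λ k _ → Vn-triangular 1≤n k) , Vn-independent 1≤n , Pcirc-lin∈span-Vn 1≤n
  where
  1≤n : 1 ≤ n
  1≤n = ≤-trans (s≤s z≤n) 2≤n
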